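{- For every integer $n\ge 0$, let $\mathcal{H}M_n$ denote the total number of humps over all Motzkin paths of length $n$, and let \[ S(2,1;n)=\sum_{\lambda} f^\lambda, \] where the sum is over all partitions $\lambda=(\lambda_1,\lambda_2,\ldots)$ of $n$ with $\lambda_3\le 1$. Then \[ \mathcal{H}M_n=S(2,1;n)-1. \]
   Context: For a partition $\lambda$, $f^\lambda$ denotes the number of standard Young tableaux of shape $\lambda$. A Motzkin path of length $n$ is a lattice path from $(0,0)$ to $(n,0)$ using flat-steps $(1,0)$, up-steps $(1,1)$ and down-steps $(1,-1)$ that never goes below the $x$-axis. A hump in a Motzkin path is a (contiguous) occurrence of an up-step, followed by zero or more flat-steps, followed by a down-step. -}

module Defs where

open import Data.Nat using (ℕ; zero; suc; _+_; _≤ᵇ_; _<ᵇ_; _≡ᵇ_)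
open import Data.Bool using (Bool; true; false; _∧_; if_then_else_)
open import Data.List using (List; []; _∷_; map; filter; concatMap; concat; upTo)
open import Data.Nat.ListAction using (sum)
open import Data.Bool using (T?)

listsOf : {A : Set} → ℕ → List A → List (List A)
listsOf zero    xs = [] ∷ []
listsOf (suc k) xs = concatMap (λ x → map (x ∷_) (listsOf k xs)) xs

allᵇ : {A : Set} → (A → Bool) → List A → Bool
allᵇ p []       = true
allᵇ p (x ∷ xs) = p x ∧ allᵇ p xs

countᵇ : {A : Set} → (A → Bool) → List A → ℕ
countᵇ p []       = 0
countᵇ p (x ∷ xs) = (if p x then 1 else 0) + countᵇ p xs

oneTo : ℕ → List ℕ
oneTo n = map suc (upTo n)

data Step : Set where
  U F D : Step          -- up (1,1), flat (1,0), down (1,-1)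

allSteps : List Step
allSteps = U ∷ F ∷ D ∷ []

validFrom : ℕ → List Step → Bool
validFrom zero    []       = true
validFrom (suc h) []       = false
validFrom h       (U ∷ w)  = validFrom (suc h) w
validFrom h       (F ∷ w)  = validFrom h w
validFrom zero    (D ∷ w)  = false
validFrom (suc h) (D ∷ w)  = validFrom h w

isMotzkin : List Step → Bool
isMotzkin = validFrom 0

motzkinPaths : ℕ → List (List Step)
motzkinPaths n = filter (λ w → T? (isMotzkin w)) (listsOf n allSteps)

flatsThenDown : List Step → Bool
flatsThenDown (F ∷ w) = flatsThenDown w
flatsThenDown (D ∷ w) = true
flatsThenDown _       = false

-- number of humps: occurrences of U F^k D (k ≥ 0) as contiguous factors
humps : List Step → ℕ
humps []      = 0
humps (U ∷ w) = (if flatsThenDown w then 1 else 0) + humps w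
humps (F ∷ w) = humps w
humps (D ∷ w) = humps w

HM : ℕ → ℕ
HM n = sum (map humps (motzkinPaths n))

weaklyDecPos : List ℕ → Bool
weaklyDecPos []            = true
weaklyDecPos (a ∷ [])      = 1 ≤ᵇ a
weaklyDecPos (a ∷ b ∷ xs)  = (b ≤ᵇ a) ∧ weaklyDecPos (b ∷ xs)

isPartitionOf : ℕ → List ℕ → Bool
isPartitionOf n λs = weaklyDecPos λs ∧ (sum λs ≡ᵇ n)

candidateParts : ℕ → List (List ℕ)
candidateParts n = concatMap (λ k → listsOf k (oneTo n)) (upTo (suc n))

partitions : ℕ → List (List ℕ)
partitions n = filter (λ λs → T? (isPartitionOf n λs)) (candidateParts n)

-- i-th part (0-indexed), 0 if absent
part : ℕ → List ℕ → ℕ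
part i       []       = 0
part zero    (a ∷ xs) = a
part (suc i) (a ∷ xs) = part i xs

-- a filling of shape λ is a list of rows (row i has λ_i entries)
fillings : ℕ → List ℕ → List (List (List ℕ))
fillings n []       = [] ∷ []
fillings n (a ∷ λs) = concatMap (λ r → map (r ∷_) (fillings n λs)) (listsOf a (oneTo n))

strictlyInc : List ℕ → Bool
strictlyInc []           = true
strictlyInc (a ∷ [])     = true
strictlyInc (a ∷ b ∷ xs) = (a <ᵇ b) ∧ strictlyInc (b ∷ xs)

belowInc : List ℕ → List ℕ → Bool
belowInc _        []       = true
belowInc []       (b ∷ s)  = false
belowInc (a ∷ r)  (b ∷ s)  = (a <ᵇ b) ∧ belowInc r s

colsInc : List (List ℕ) → Bool
colsInc []           = true
colsInc (r ∷ [])     = true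
colsInc (r ∷ s ∷ rs) = belowInc r s ∧ colsInc (s ∷ rs)

usesEachOnce : ℕ → List (List ℕ) → Bool
usesEachOnce n t = allᵇ (λ i → countᵇ (λ x → x ≡ᵇ i) (concat t) ≡ᵇ 1) (oneTo n)

isSYT : ℕ → List (List ℕ) → Bool
isSYT n t = usesEachOnce n t ∧ allᵇ strictlyInc t ∧ colsInc t

fˡ : List ℕ → ℕ
fˡ λs = countᵇ (isSYT (sum λs)) (fillings (sum λs) λs)

S21 : ℕ → ℕ
S21 n = sum (map fˡ (filter (λ λs → T? (part 2 λs ≤ᵇ 1)) (partitions n)))

-- Both sides are sums of trinomial coefficients T(m, 1) = [x](1 + x + x⁻¹)^m.  Summing the humps
-- over the first step of a path gives HM(n+1) = ∑_{m<n} (m+1) M_m, and (m+1) M_m = T(m+1, 1) by the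
-- reflection principle M_m = T(m, 0) − T(m, 2) together with the derivative of (1 + x + x⁻¹)^(m+1).
-- On the other side, writing U, D or F at position i according as i lies in the first row, the
-- second row or the first column below them turns the standard tableaux of shapes with λ₃ ≤ 1
-- bijectively into ballot words in which no F precedes the first D, and the recursion for these
-- words shows that there are 1 + ∑_{1≤m≤n} T(m, 1) of length n + 1.

module Submission where

open import Defs
open import Data.Bool using (Bool; true; false; _∧_; _∨_; if_then_else_; T; T?)
open import Data.Bool.Properties using (∧-identityʳ; ∧-zeroʳ; T-≡)
open import Data.Empty using (⊥-elim)
open import Data.Unit using (⊤)
open import Data.List using (List; []; _∷_; map; filterᵇ; concatMap; concat; _++_; length; drop; upTo; applyUpTo)
open import Data.List.Properties using (length-map; length-++; drop-[])
open import Data.List.Relation.Unary.All as All using (All; []; _∷_)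
open import Data.List.Relation.Unary.All.Properties using (++⁺; ++⁻ˡ; ++⁻ʳ; concat⁺; map⁺; map⁻; all-filter; filter⁺)
open import Data.Nat using (ℕ; zero; suc; _+_; _*_; _≤_; _<_; z≤n; s≤s; _<ᵇ_; _≤ᵇ_; _≡ᵇ_)
open import Data.Nat.ListAction using (sum)
open import Data.Nat.Properties
open import Data.Nat.Tactic.RingSolver using (solve-∀)
open import Data.Product using (_×_; _,_; proj₁; proj₂)
open import Data.Sum using (_⊎_; inj₁; inj₂)
open import Function.Bundles using (Equivalence)
open import Relation.Binary.PropositionalEquality
open import Relation.Nullary using (¬_; Dec; yes; no)

private
  variable
    A B : Set

iverson : Bool → ℕ
iverson true  = 1
iverson false = 0

∑ : List A → (A → ℕ) → ℕ
∑ []       f = 0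
∑ (x ∷ xs) f = f x + ∑ xs f

sum-map≡∑ : (xs : List A) (f : A → ℕ) → sum (map f xs) ≡ ∑ xs f
sum-map≡∑ []       f = refl
sum-map≡∑ (x ∷ xs) f = cong (f x +_) (sum-map≡∑ xs f)

countᵇ≡∑ : (p : A → Bool) (xs : List A) → countᵇ p xs ≡ ∑ xs (λ x → iverson (p x))
countᵇ≡∑ p []       = refl
countᵇ≡∑ p (x ∷ xs) with p x
... | true  = cong suc (countᵇ≡∑ p xs)
... | false = countᵇ≡∑ p xs

∑-++ : (xs ys : List A) (f : A → ℕ) → ∑ (xs ++ ys) f ≡ ∑ xs f + ∑ ys f
∑-++ []       ys f = refl
∑-++ (x ∷ xs) ys f = trans (cong (f x +_) (∑-++ xs ys f)) (sym (+-assoc (f x) _ _))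

∑-map : (xs : List A) (g : A → B) (f : B → ℕ) → ∑ (map g xs) f ≡ ∑ xs (λ x → f (g x))
∑-map []       g f = refl
∑-map (x ∷ xs) g f = cong (f (g x) +_) (∑-map xs g f)

∑-concatMap : (xs : List A) (g : A → List B) (f : B → ℕ) →
              ∑ (concatMap g xs) f ≡ ∑ xs (λ x → ∑ (g x) f)
∑-concatMap []       g f = refl
∑-concatMap (x ∷ xs) g f = trans (∑-++ (g x) (concatMap g xs) f) (cong (∑ (g x) f +_) (∑-concatMap xs g f))

∑-cong : (xs : List A) {f g : A → ℕ} → (∀ x → f x ≡ g x) → ∑ xs f ≡ ∑ xs g
∑-cong []       f≗g = refl
∑-cong (x ∷ xs) f≗g = cong₂ _+_ (f≗g x) (∑-cong xs f≗g)

∑-congᴬ : {P : A → Set} {xs : List A} {f g : A → ℕ} → All P xs → (∀ x → P x → f x ≡ g x) → ∑ xs f ≡ ∑ xs g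
∑-congᴬ []         f≗g = refl
∑-congᴬ (px ∷ pxs) f≗g = cong₂ _+_ (f≗g _ px) (∑-congᴬ pxs f≗g)

∑-zero : (xs : List A) → ∑ xs (λ _ → 0) ≡ 0
∑-zero []       = refl
∑-zero (x ∷ xs) = ∑-zero xs

∑-one : (xs : List A) → ∑ xs (λ _ → 1) ≡ length xs
∑-one []       = refl
∑-one (x ∷ xs) = cong suc (∑-one xs)

∑-+ : (xs : List A) (f g : A → ℕ) → ∑ xs (λ x → f x + g x) ≡ ∑ xs f + ∑ xs g
∑-+ []       f g = refl
∑-+ (x ∷ xs) f g = trans (cong (f x + g x +_) (∑-+ xs f g)) (+-interchange (f x) (g x) _ _)
  where
  +-interchange : ∀ a b c d → (a + b) + (c + d) ≡ (a + c) + (b + d)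
  +-interchange = solve-∀

∑-*ˡ : (xs : List A) (c : ℕ) (f : A → ℕ) → ∑ xs (λ x → c * f x) ≡ c * ∑ xs f
∑-*ˡ []       c f = sym (*-zeroʳ c)
∑-*ˡ (x ∷ xs) c f = trans (cong (c * f x +_) (∑-*ˡ xs c f)) (sym (*-distribˡ-+ c (f x) _))

∑-*ʳ : (xs : List A) (c : ℕ) (f : A → ℕ) → ∑ xs (λ x → f x * c) ≡ ∑ xs f * c
∑-*ʳ []       c f = refl
∑-*ʳ (x ∷ xs) c f = trans (cong (f x * c +_) (∑-*ʳ xs c f)) (sym (*-distribʳ-+ c (f x) _))

∑-comm : (xs : List A) (ys : List B) (f : A → B → ℕ) →
         ∑ xs (λ x → ∑ ys (f x)) ≡ ∑ ys (λ y → ∑ xs (λ x → f x y))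
∑-comm []       ys f = sym (∑-zero ys)
∑-comm (x ∷ xs) ys f = trans (cong (∑ ys (f x) +_) (∑-comm xs ys f)) (sym (∑-+ ys (f x) _))

∑-filterᵇ : (xs : List A) (p : A → Bool) (f : A → ℕ) →
           ∑ (filterᵇ p xs) f ≡ ∑ xs (λ x → if p x then f x else 0)
∑-filterᵇ []       p f = refl
∑-filterᵇ (x ∷ xs) p f with p x
... | true  = cong (f x +_) (∑-filterᵇ xs p f)
... | false = ∑-filterᵇ xs p f

-- Humps of Motzkin paths

words : ℕ → List (List Step)
words n = listsOf n allSteps

∑-words-suc : (n : ℕ) (f : List Step → ℕ) →
  ∑ (words (suc n)) f ≡ ∑ (words n) (λ w → f (U ∷ w)) + (∑ (words n) (λ w → f (F ∷ w)) + ∑ (words n) (λ w → f (D ∷ w)))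
∑-words-suc n f = begin
  ∑ (words (suc n)) f
    ≡⟨ ∑-concatMap allSteps (λ s → map (s ∷_) (words n)) f ⟩
  ∑ (map (U ∷_) (words n)) f + (∑ (map (F ∷_) (words n)) f + (∑ (map (D ∷_) (words n)) f + 0))
    ≡⟨ cong₂ _+_ (∑-map (words n) (U ∷_) f)
         (cong₂ _+_ (∑-map (words n) (F ∷_) f) (trans (+-identityʳ _) (∑-map (words n) (D ∷_) f))) ⟩
  ∑ (words n) (λ w → f (U ∷ w)) + (∑ (words n) (λ w → f (F ∷ w)) + ∑ (words n) (λ w → f (D ∷ w))) ∎
  where open ≡-Reasoning

motzkinFrom : ℕ → ℕ → ℕ
motzkinFrom zero    zero    = 1
motzkinFrom (suc h) zero    = 0
motzkinFrom zero    (suc n) = motzkinFrom 1 n + motzkinFrom 0 n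
motzkinFrom (suc h) (suc n) = motzkinFrom (suc (suc h)) n + (motzkinFrom (suc h) n + motzkinFrom h n)

flatsDownFrom : ℕ → ℕ → ℕ
flatsDownFrom h       zero    = 0
flatsDownFrom zero    (suc n) = flatsDownFrom zero n
flatsDownFrom (suc h) (suc n) = flatsDownFrom (suc h) n + motzkinFrom h n

humpsFrom : ℕ → ℕ → ℕ
humpsFrom h       zero    = 0
humpsFrom zero    (suc n) = (flatsDownFrom 1 n + humpsFrom 1 n) + humpsFrom 0 n
humpsFrom (suc h) (suc n) = (flatsDownFrom (suc (suc h)) n + humpsFrom (suc (suc h)) n) + (humpsFrom (suc h) n + humpsFrom h n)

onPathsFrom : ℕ → (List Step → ℕ) → List Step → ℕ
onPathsFrom h f w = if validFrom h w then f w else 0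

∑-validFrom : ∀ n h → ∑ (words n) (λ w → iverson (validFrom h w)) ≡ motzkinFrom h n
∑-validFrom zero    zero    = refl
∑-validFrom zero    (suc h) = refl
∑-validFrom (suc n) zero    = trans (∑-words-suc n _)
  (cong₂ _+_ (∑-validFrom n 1) (trans (cong₂ _+_ (∑-validFrom n 0) (∑-zero (words n))) (+-identityʳ _)))
∑-validFrom (suc n) (suc h) = trans (∑-words-suc n _)
  (cong₂ _+_ (∑-validFrom n (suc (suc h))) (cong₂ _+_ (∑-validFrom n (suc h)) (∑-validFrom n h)))

onPathsFrom-up-flatsThenDown : ∀ h w → onPathsFrom h (λ v → iverson (flatsThenDown v)) (U ∷ w) ≡ 0
onPathsFrom-up-flatsThenDown zero    w with validFrom 1 w
... | true  = refl
... | false = refl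
onPathsFrom-up-flatsThenDown (suc h) w with validFrom (suc (suc h)) w
... | true  = refl
... | false = refl

∑-flatsThenDown : ∀ n h → ∑ (words n) (onPathsFrom h (λ w → iverson (flatsThenDown w))) ≡ flatsDownFrom h n
∑-flatsThenDown zero    zero    = refl
∑-flatsThenDown zero    (suc h) = refl
∑-flatsThenDown (suc n) zero    = begin
  _ ≡⟨ ∑-words-suc n _ ⟩
  _ ≡⟨ cong₂ _+_ (trans (∑-cong (words n) (onPathsFrom-up-flatsThenDown 0)) (∑-zero (words n)))
                 (trans (cong₂ _+_ (∑-flatsThenDown n 0) (∑-zero (words n))) (+-identityʳ _)) ⟩
  flatsDownFrom 0 n ∎
  where open ≡-Reasoning
∑-flatsThenDown (suc n) (suc h) = begin
  _ ≡⟨ ∑-words-suc n _ ⟩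
  _ ≡⟨ cong₂ _+_ (trans (∑-cong (words n) (onPathsFrom-up-flatsThenDown (suc h))) (∑-zero (words n)))
                 (cong₂ _+_ (∑-flatsThenDown n (suc h)) (trans (∑-cong (words n) down) (∑-validFrom n h))) ⟩
  flatsDownFrom (suc h) n + motzkinFrom h n ∎
  where
  open ≡-Reasoning
  down : ∀ w → onPathsFrom (suc h) (λ v → iverson (flatsThenDown v)) (D ∷ w) ≡ iverson (validFrom h w)
  down w with validFrom h w
  ... | true  = refl
  ... | false = refl

onPathsFrom-up-humps : ∀ h w → onPathsFrom h humps (U ∷ w)
  ≡ onPathsFrom (suc h) (λ v → iverson (flatsThenDown v)) w + onPathsFrom (suc h) humps w
onPathsFrom-up-humps zero    w with validFrom 1 w | flatsThenDown w
... | true  | true  = refl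
... | true  | false = refl
... | false | _     = refl
onPathsFrom-up-humps (suc h) w with validFrom (suc (suc h)) w | flatsThenDown w
... | true  | true  = refl
... | true  | false = refl
... | false | _     = refl

∑-humps : ∀ n h → ∑ (words n) (onPathsFrom h humps) ≡ humpsFrom h n

∑-humps-up : ∀ n h → ∑ (words n) (λ w → onPathsFrom h humps (U ∷ w)) ≡ flatsDownFrom (suc h) n + humpsFrom (suc h) n
∑-humps-up n h = trans (∑-cong (words n) (onPathsFrom-up-humps h))
  (trans (∑-+ (words n) _ _) (cong₂ _+_ (∑-flatsThenDown n (suc h)) (∑-humps n (suc h))))

∑-humps zero    zero    = refl
∑-humps zero    (suc h) = refl
∑-humps (suc n) zero    = trans (∑-words-suc n _)
  (cong₂ _+_ (∑-humps-up n 0) (trans (cong₂ _+_ (∑-humps n 0) (∑-zero (words n))) (+-identityʳ _)))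
∑-humps (suc n) (suc h) = trans (∑-words-suc n _)
  (cong₂ _+_ (∑-humps-up n (suc h)) (cong₂ _+_ (∑-humps n (suc h)) (∑-humps n h)))

HM≡humpsFrom : ∀ n → HM n ≡ humpsFrom 0 n
HM≡humpsFrom n = trans (sum-map≡∑ (motzkinPaths n) humps) (trans (∑-filterᵇ (words n) isMotzkin humps) (∑-humps n 0))

lower : (ℕ → ℕ) → ℕ → ℕ
lower f zero    = 0
lower f (suc h) = f h

motzkinFrom-suc : ∀ h n → motzkinFrom h (suc n) ≡ motzkinFrom (suc h) n + (motzkinFrom h n + lower (λ k → motzkinFrom k n) h)
motzkinFrom-suc zero    n = cong (motzkinFrom 1 n +_) (sym (+-identityʳ _))
motzkinFrom-suc (suc h) n = refl

humpsFrom-suc : ∀ h n → humpsFrom h (suc n)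
  ≡ (flatsDownFrom (suc h) n + humpsFrom (suc h) n) + (humpsFrom h n + lower (λ k → humpsFrom k n) h)
humpsFrom-suc zero    n = cong (flatsDownFrom 1 n + humpsFrom 1 n +_) (sym (+-identityʳ (humpsFrom 0 n)))
humpsFrom-suc (suc h) n = refl

weightedMotzkin : ℕ → ℕ → ℕ
weightedMotzkin h zero    = 0
weightedMotzkin h (suc n) = weightedMotzkin h n + suc n * motzkinFrom h n

lower-weightedMotzkin : ∀ h n → lower (λ k → weightedMotzkin k (suc n)) h
  ≡ lower (λ k → weightedMotzkin k n) h + suc n * lower (λ k → motzkinFrom k n) h
lower-weightedMotzkin zero    n = sym (*-zeroʳ (suc n))
lower-weightedMotzkin (suc h) n = refl

weightedMotzkin-step : ∀ n h →
  flatsDownFrom (suc h) (suc n) + (weightedMotzkin (suc h) n + (weightedMotzkin h n + lower (λ k → weightedMotzkin k n) h))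
    ≡ weightedMotzkin h (suc n)
weightedMotzkin-step zero    zero    = refl
weightedMotzkin-step zero    (suc h) = +-identityʳ (motzkinFrom (suc h) 0 + 0)
weightedMotzkin-step (suc n) h = begin
  (F₁ + M h (suc n)) + ((W (suc h) n + suc n * M (suc h) n) + ((W h n + suc n * M h n) + lower (λ k → W k (suc n)) h))
    ≡⟨ cong (λ z → (F₁ + M h (suc n)) + ((W (suc h) n + suc n * M (suc h) n) + ((W h n + suc n * M h n) + z)))
            (lower-weightedMotzkin h n) ⟩
  (F₁ + M h (suc n)) + ((W (suc h) n + suc n * M (suc h) n) + ((W h n + suc n * M h n) + (Wₗ + suc n * Mₗ)))
    ≡⟨ regroup F₁ (M h (suc n)) (W (suc h) n) (M (suc h) n) (W h n) (M h n) Wₗ Mₗ (suc n) ⟩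
  (F₁ + (W (suc h) n + (W h n + Wₗ))) + M h (suc n) + suc n * (M (suc h) n + (M h n + Mₗ))
    ≡⟨ cong₂ (λ u v → u + M h (suc n) + suc n * v) (weightedMotzkin-step n h) (sym (motzkinFrom-suc h n)) ⟩
  W h (suc n) + M h (suc n) + suc n * M h (suc n)
    ≡⟨ +-assoc (W h (suc n)) _ _ ⟩
  W h (suc (suc n)) ∎
  where
  open ≡-Reasoning
  M = motzkinFrom
  W = weightedMotzkin
  F₁ = flatsDownFrom (suc h) (suc n)
  Wₗ = lower (λ k → W k n) h
  Mₗ = lower (λ k → M k n) h
  regroup : ∀ c a k₁ x k₀ y kₗ z l →
    (c + a) + ((k₁ + l * x) + ((k₀ + l * y) + (kₗ + l * z))) ≡ (c + (k₁ + (k₀ + kₗ))) + a + l * (x + (y + z))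
  regroup = solve-∀

humpsFrom≡weightedMotzkin : ∀ n h → humpsFrom h (suc n) ≡ weightedMotzkin h n
humpsFrom≡weightedMotzkin zero    zero    = refl
humpsFrom≡weightedMotzkin zero    (suc h) = refl
humpsFrom≡weightedMotzkin (suc n) h = begin
  humpsFrom h (suc (suc n))
    ≡⟨ humpsFrom-suc h (suc n) ⟩
  (flatsDownFrom (suc h) (suc n) + humpsFrom (suc h) (suc n)) + (humpsFrom h (suc n) + lower (λ k → humpsFrom k (suc n)) h)
    ≡⟨ cong₂ _+_ (cong (flatsDownFrom (suc h) (suc n) +_) (humpsFrom≡weightedMotzkin n (suc h)))
                 (cong₂ _+_ (humpsFrom≡weightedMotzkin n h) (lower-cong h)) ⟩
  (flatsDownFrom (suc h) (suc n) + weightedMotzkin (suc h) n) + (weightedMotzkin h n + lower (λ k → weightedMotzkin k n) h)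
    ≡⟨ +-assoc (flatsDownFrom (suc h) (suc n)) _ _ ⟩
  _ ≡⟨ weightedMotzkin-step n h ⟩
  weightedMotzkin h (suc n) ∎
  where
  open ≡-Reasoning
  lower-cong : ∀ h → lower (λ k → humpsFrom k (suc n)) h ≡ lower (λ k → weightedMotzkin k n) h
  lower-cong zero    = refl
  lower-cong (suc h) = humpsFrom≡weightedMotzkin n h

-- Trinomial coefficients

distFrom1 : ℕ → ℕ
distFrom1 zero    = 1
distFrom1 (suc k) = k

-- trinomial n k is the coefficient of x^k in (x + 1 + x⁻¹)^n; the coefficient of x^(−1) equals
-- that of x^1, hence distFrom1 in the recursion.
trinomial : ℕ → ℕ → ℕ
trinomial zero    zero    = 1
trinomial zero    (suc k) = 0
trinomial (suc n) k       = trinomial n (distFrom1 k) + (trinomial n k + trinomial n (suc k))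

-- Coefficient of x^k in d/dx (x + 1 + x⁻¹)^(n+1) = (n + 1) (1 − x⁻²) (x + 1 + x⁻¹)^n.
trinomial-derivative : ∀ n k → suc k * trinomial (suc n) (suc k) + suc n * trinomial n (suc (suc k)) ≡ suc n * trinomial n k
trinomial-derivative zero    zero    = refl
trinomial-derivative zero    (suc k) = cong (_+ (1 * trinomial zero (suc (suc (suc k))))) (*-zeroʳ (suc (suc k)))
trinomial-derivative (suc m) k =
  combine k (suc m) (t (distFrom1 k)) (t k) (t (suc k)) (t (suc (suc k))) (t (suc (suc (suc k)))) (trinomial (suc m) (suc k))
          (at-distFrom1 k) (trinomial-derivative m k) (trinomial-derivative m (suc k))
  where
  t = trinomial m
  at-distFrom1 : ∀ k → k * trinomial (suc m) k + suc m * t (suc k) ≡ suc m * t (distFrom1 k)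
  at-distFrom1 zero    = refl
  at-distFrom1 (suc k) = trinomial-derivative m k
  combine : ∀ k N a b c d e x →
    k * (a + (b + c)) + N * c ≡ N * a →
    suc k * x + N * d ≡ N * b →
    suc (suc k) * (c + (d + e)) + N * e ≡ N * c →
    suc k * ((a + (b + c)) + (x + (c + (d + e)))) + suc N * (c + (d + e)) ≡ suc N * (a + (b + c))
  combine k N a b c d e x e₁ e₂ e₃ = +-cancelʳ-≡ (N * c + N * d + N * e) _ _ (begin
    suc k * ((a + (b + c)) + (x + (c + (d + e)))) + suc N * (c + (d + e)) + (N * c + N * d + N * e)
      ≡⟨ split k N a b c d e x ⟩
    (k * (a + (b + c)) + N * c) + (suc k * x + N * d) + (suc (suc k) * (c + (d + e)) + N * e) + (a + (b + c)) + N * (c + (d + e))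
      ≡⟨ cong₂ (λ u v → u + v + (suc (suc k) * (c + (d + e)) + N * e) + (a + (b + c)) + N * (c + (d + e))) e₁ e₂ ⟩
    N * a + N * b + (suc (suc k) * (c + (d + e)) + N * e) + (a + (b + c)) + N * (c + (d + e))
      ≡⟨ cong (λ u → N * a + N * b + u + (a + (b + c)) + N * (c + (d + e))) e₃ ⟩
    N * a + N * b + N * c + (a + (b + c)) + N * (c + (d + e))
      ≡⟨ join N a b c d e ⟩
    suc N * (a + (b + c)) + (N * c + N * d + N * e) ∎)
    where
    open ≡-Reasoning
    split : ∀ k N a b c d e x →
      suc k * ((a + (b + c)) + (x + (c + (d + e)))) + suc N * (c + (d + e)) + (N * c + N * d + N * e)
        ≡ (k * (a + (b + c)) + N * c) + (suc k * x + N * d) + (suc (suc k) * (c + (d + e)) + N * e) + (a + (b + c)) + N * (c + (d + e))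
    split = solve-∀
    join : ∀ N a b c d e →
      N * a + N * b + N * c + (a + (b + c)) + N * (c + (d + e)) ≡ suc N * (a + (b + c)) + (N * c + N * d + N * e)
    join = solve-∀

-- Reflection principle: paths from height h that would reach −1 correspond to paths ending at −2.
motzkinFrom+trinomial : ∀ n h → motzkinFrom h n + trinomial n (suc (suc h)) ≡ trinomial n h
motzkinFrom+trinomial zero    zero    = refl
motzkinFrom+trinomial zero    (suc h) = refl
motzkinFrom+trinomial (suc n) zero    = begin
  (M 1 n + M 0 n) + (t 1 + (t 2 + t 3)) ≡⟨ regroup (M 1 n) (M 0 n) (t 1) (t 2) (t 3) ⟩
  (M 1 n + t 3) + ((M 0 n + t 2) + t 1) ≡⟨ cong₂ (λ u v → u + (v + t 1)) (motzkinFrom+trinomial n 1) (motzkinFrom+trinomial n 0) ⟩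
  t 1 + (t 0 + t 1) ∎
  where
  open ≡-Reasoning
  M = motzkinFrom
  t = trinomial n
  regroup : ∀ a b x y z → (a + b) + (x + (y + z)) ≡ (a + z) + ((b + y) + x)
  regroup = solve-∀
motzkinFrom+trinomial (suc n) (suc h) = begin
  (M (2 + h) n + (M (1 + h) n + M h n)) + (t (2 + h) + (t (3 + h) + t (4 + h)))
    ≡⟨ regroup (M (2 + h) n) (M (1 + h) n) (M h n) _ _ _ ⟩
  (M (2 + h) n + t (4 + h)) + ((M (1 + h) n + t (3 + h)) + (M h n + t (2 + h)))
    ≡⟨ cong₂ _+_ (motzkinFrom+trinomial n (2 + h)) (cong₂ _+_ (motzkinFrom+trinomial n (1 + h)) (motzkinFrom+trinomial n h)) ⟩
  t (2 + h) + (t (1 + h) + t h)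
    ≡⟨ reverse (t (2 + h)) (t (1 + h)) (t h) ⟩
  t h + (t (1 + h) + t (2 + h)) ∎
  where
  open ≡-Reasoning
  M = motzkinFrom
  t = trinomial n
  regroup : ∀ a b c x y z → (a + (b + c)) + (x + (y + z)) ≡ (a + z) + ((b + y) + (c + x))
  regroup = solve-∀
  reverse : ∀ a b c → a + (b + c) ≡ c + (b + a)
  reverse = solve-∀

suc*motzkin : ∀ n → suc n * motzkinFrom 0 n ≡ trinomial (suc n) 1
suc*motzkin n = sym (+-cancelʳ-≡ (suc n * trinomial n 2) _ _ (begin
  trinomial (suc n) 1 + suc n * trinomial n 2     ≡⟨ cong (_+ suc n * trinomial n 2) (sym (*-identityˡ (trinomial (suc n) 1))) ⟩
  1 * trinomial (suc n) 1 + suc n * trinomial n 2 ≡⟨ trinomial-derivative n 0 ⟩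
  suc n * trinomial n 0                           ≡⟨ cong (suc n *_) (sym (motzkinFrom+trinomial n 0)) ⟩
  suc n * (motzkinFrom 0 n + trinomial n 2)       ≡⟨ *-distribˡ-+ (suc n) (motzkinFrom 0 n) _ ⟩
  suc n * motzkinFrom 0 n + suc n * trinomial n 2 ∎))
  where open ≡-Reasoning

trinomial₁-partialSum : ℕ → ℕ
trinomial₁-partialSum zero    = 0
trinomial₁-partialSum (suc n) = trinomial₁-partialSum n + trinomial (suc n) 1

humpsFrom-closed : ∀ n → humpsFrom 0 (suc n) ≡ trinomial₁-partialSum n
humpsFrom-closed n = trans (humpsFrom≡weightedMotzkin n 0) (weighted n)
  where
  weighted : ∀ n → weightedMotzkin 0 n ≡ trinomial₁-partialSum n
  weighted zero    = refl
  weighted (suc n) = cong₂ _+_ (weighted n) (suc*motzkin n)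

-- Ballot words

-- h is the excess of U's over D's read so far; an F (an entry of the column below the second row)
-- may only come after a D.
ballotFrom : (afterDown : Bool) → ℕ → List Step → Bool
ballotFrom s     h       []      = true
ballotFrom s     h       (U ∷ w) = ballotFrom s (suc h) w
ballotFrom s     zero    (D ∷ w) = false
ballotFrom s     (suc h) (D ∷ w) = ballotFrom true h w
ballotFrom false h       (F ∷ w) = false
ballotFrom true  h       (F ∷ w) = ballotFrom true h w

ballots : ℕ → ℕ → ℕ
ballots h       zero    = 1
ballots zero    (suc n) = ballots 1 n + ballots 0 n
ballots (suc h) (suc n) = ballots (suc (suc h)) n + (ballots (suc h) n + ballots h n)

tableauWords : ℕ → ℕ → ℕ
tableauWords h       zero    = 1
tableauWords zero    (suc n) = tableauWords 1 n
tableauWords (suc h) (suc n) = tableauWords (suc (suc h)) n + ballots h n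

∑-ballotFrom-afterDown : ∀ n h → ∑ (words n) (λ w → iverson (ballotFrom true h w)) ≡ ballots h n
∑-ballotFrom-afterDown zero    h       = refl
∑-ballotFrom-afterDown (suc n) zero    = trans (∑-words-suc n _)
  (cong₂ _+_ (∑-ballotFrom-afterDown n 1) (trans (cong₂ _+_ (∑-ballotFrom-afterDown n 0) (∑-zero (words n))) (+-identityʳ _)))
∑-ballotFrom-afterDown (suc n) (suc h) = trans (∑-words-suc n _)
  (cong₂ _+_ (∑-ballotFrom-afterDown n (suc (suc h))) (cong₂ _+_ (∑-ballotFrom-afterDown n (suc h)) (∑-ballotFrom-afterDown n h)))

∑-ballotFrom : ∀ n h → ∑ (words n) (λ w → iverson (ballotFrom false h w)) ≡ tableauWords h n
∑-ballotFrom zero    h       = refl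
∑-ballotFrom (suc n) zero    = trans (∑-words-suc n _)
  (trans (cong₂ _+_ (∑-ballotFrom n 1) (cong₂ _+_ (∑-zero (words n)) (∑-zero (words n)))) (+-identityʳ _))
∑-ballotFrom (suc n) (suc h) = trans (∑-words-suc n _)
  (cong₂ _+_ (∑-ballotFrom n (suc (suc h))) (cong₂ _+_ (∑-zero (words n)) (∑-ballotFrom-afterDown n h)))

trinomialSum : ℕ → ℕ → ℕ
trinomialSum n zero    = 0
trinomialSum n (suc m) = trinomialSum n m + trinomial n (suc m)

trinomialSum-zero : ∀ m → trinomialSum 0 m ≡ 0
trinomialSum-zero zero    = refl
trinomialSum-zero (suc m) = trans (+-identityʳ _) (trinomialSum-zero m)

trinomialSum-one : ∀ m → trinomialSum 1 (suc m) ≡ 1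
trinomialSum-one zero    = refl
trinomialSum-one (suc m) = trans (+-identityʳ _) (trinomialSum-one m)

trinomialSum-suc : ∀ n m → trinomialSum (suc n) (suc m) + trinomial n 1
  ≡ trinomial n 0 + (trinomialSum n m + (trinomialSum n (suc m) + trinomialSum n (suc (suc m))))
trinomialSum-suc n zero    = regroup (trinomial n 0) (trinomial n 1) (trinomial n 2)
  where
  regroup : ∀ a b c → 0 + (a + (b + c)) + b ≡ a + (0 + ((0 + b) + ((0 + b) + c)))
  regroup = solve-∀
trinomialSum-suc n (suc m) = begin
  (Σ′ (suc m) + t′ (suc (suc m))) + t 1
    ≡⟨ swap (Σ′ (suc m)) (t′ (suc (suc m))) (t 1) ⟩
  (Σ′ (suc m) + t 1) + t′ (suc (suc m))
    ≡⟨ cong (_+ t′ (suc (suc m))) (trinomialSum-suc n m) ⟩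
  (t 0 + (Σ m + (Σ (suc m) + Σ (suc (suc m))))) + (t (suc m) + (t (suc (suc m)) + t (suc (suc (suc m)))))
    ≡⟨ regroup (t 0) (Σ m) (Σ (suc m)) (Σ (suc (suc m))) (t (suc m)) (t (suc (suc m))) (t (suc (suc (suc m)))) ⟩
  t 0 + ((Σ m + t (suc m)) + ((Σ (suc m) + t (suc (suc m))) + (Σ (suc (suc m)) + t (suc (suc (suc m)))))) ∎
  where
  open ≡-Reasoning
  t = trinomial n
  t′ = trinomial (suc n)
  Σ = trinomialSum n
  Σ′ = trinomialSum (suc n)
  swap : ∀ a b c → a + b + c ≡ a + c + b
  swap = solve-∀
  regroup : ∀ a b c d x y z → (a + (b + (c + d))) + (x + (y + z)) ≡ a + ((b + x) + ((c + y) + (d + z)))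
  regroup = solve-∀

ballots-closed : ∀ n h → ballots h n ≡ trinomial n 0 + (trinomialSum n h + trinomialSum n (suc h))
ballots-closed zero    h       = sym (cong (1 +_) (cong₂ _+_ (trinomialSum-zero h) (trinomialSum-zero (suc h))))
ballots-closed (suc n) zero    = begin
  ballots 1 n + ballots 0 n
    ≡⟨ cong₂ _+_ (ballots-closed n 1) (ballots-closed n 0) ⟩
  (t 0 + ((0 + t 1) + ((0 + t 1) + t 2))) + (t 0 + (0 + (0 + t 1)))
    ≡⟨ regroup (t 0) (t 1) (t 2) ⟩
  (t 1 + (t 0 + t 1)) + (0 + (0 + (t 0 + (t 1 + t 2)))) ∎
  where
  open ≡-Reasoning
  t = trinomial n
  regroup : ∀ a b c → (a + ((0 + b) + ((0 + b) + c))) + (a + (0 + (0 + b))) ≡ (b + (a + b)) + (0 + (0 + (a + (b + c))))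
  regroup = solve-∀
ballots-closed (suc n) (suc h) = begin
  ballots (suc (suc h)) n + (ballots (suc h) n + ballots h n)
    ≡⟨ cong₂ _+_ (ballots-closed n (suc (suc h))) (cong₂ _+_ (ballots-closed n (suc h)) (ballots-closed n h)) ⟩
  (a + (Σ (2 + h) + Σ (3 + h))) + ((a + (Σ (1 + h) + Σ (2 + h))) + (a + (Σ h + Σ (1 + h))))
    ≡⟨ regroup a (Σ h) (Σ (1 + h)) (Σ (2 + h)) (Σ (3 + h)) ⟩
  a + ((a + (Σ h + (Σ (1 + h) + Σ (2 + h)))) + (a + (Σ (1 + h) + (Σ (2 + h) + Σ (3 + h)))))
    ≡⟨ cong (a +_) (cong₂ _+_ (sym (trinomialSum-suc n h)) (sym (trinomialSum-suc n (suc h)))) ⟩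
  a + ((Σ′ (1 + h) + b) + (Σ′ (2 + h) + b))
    ≡⟨ collect a b (Σ′ (1 + h)) (Σ′ (2 + h)) ⟩
  (b + (a + b)) + (Σ′ (1 + h) + Σ′ (2 + h)) ∎
  where
  open ≡-Reasoning
  a = trinomial n 0
  b = trinomial n 1
  Σ = trinomialSum n
  Σ′ = trinomialSum (suc n)
  regroup : ∀ a s₀ s₁ s₂ s₃ → (a + (s₂ + s₃)) + ((a + (s₁ + s₂)) + (a + (s₀ + s₁)))
                             ≡ a + ((a + (s₀ + (s₁ + s₂))) + (a + (s₁ + (s₂ + s₃))))
  regroup = solve-∀
  collect : ∀ a b x y → a + ((x + b) + (y + b)) ≡ (b + (a + b)) + (x + y)
  collect = solve-∀

ballotDiagonal : ℕ → ℕ → ℕ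
ballotDiagonal h zero    = ballots h 0
ballotDiagonal h (suc n) = ballots h (suc n) + ballotDiagonal (suc h) n

tableauWords-diagonal : ∀ n h → tableauWords (suc h) (suc n) ≡ suc (ballotDiagonal h n)
tableauWords-diagonal zero    h = refl
tableauWords-diagonal (suc n) h =
  trans (cong (_+ ballots h (suc n)) (tableauWords-diagonal n (suc h))) (cong suc (+-comm (ballotDiagonal (suc h) n) _))

ballotDiagonal-closed : ∀ n h → ballotDiagonal h n ≡ trinomial₁-partialSum n + trinomialSum (suc n) (suc h)
ballotDiagonal-closed zero    h = sym (trinomialSum-one h)
ballotDiagonal-closed (suc n) h = begin
  ballots h (suc n) + ballotDiagonal (suc h) n
    ≡⟨ cong₂ _+_ (ballots-closed (suc n) h) (ballotDiagonal-closed n (suc h)) ⟩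
  (t 0 + (Σ h + Σ (1 + h))) + (P n + Σ (2 + h))
    ≡⟨ regroup (t 0) (Σ h) (Σ (1 + h)) (P n) (Σ (2 + h)) ⟩
  P n + (t 0 + (Σ h + (Σ (1 + h) + Σ (2 + h))))
    ≡⟨ cong (P n +_) (sym (trinomialSum-suc (suc n) h)) ⟩
  P n + (trinomialSum (2 + n) (1 + h) + t 1)
    ≡⟨ swap (P n) (trinomialSum (2 + n) (1 + h)) (t 1) ⟩
  (P n + t 1) + trinomialSum (2 + n) (1 + h) ∎
  where
  open ≡-Reasoning
  t = trinomial (suc n)
  Σ = trinomialSum (suc n)
  P = trinomial₁-partialSum
  regroup : ∀ a b c d e → (a + (b + c)) + (d + e) ≡ d + (a + (b + (c + e)))
  regroup = solve-∀
  swap : ∀ a b c → a + (b + c) ≡ (a + c) + b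
  swap = solve-∀

humpsFrom+1≡tableauWords : ∀ n → humpsFrom 0 n + 1 ≡ tableauWords 0 n
humpsFrom+1≡tableauWords zero          = refl
humpsFrom+1≡tableauWords (suc zero)    = refl
humpsFrom+1≡tableauWords (suc (suc n)) = begin
  humpsFrom 0 (2 + n) + 1                                 ≡⟨ cong (_+ 1) (humpsFrom-closed (suc n)) ⟩
  trinomial₁-partialSum n + trinomial (suc n) 1 + 1       ≡⟨ +-comm _ 1 ⟩
  suc (trinomial₁-partialSum n + trinomialSum (suc n) 1)  ≡⟨ cong suc (sym (ballotDiagonal-closed n 0)) ⟩
  suc (ballotDiagonal 0 n)                                ≡⟨ sym (tableauWords-diagonal n 0) ⟩
  tableauWords 0 (2 + n)                                  ∎
  where open ≡-Reasoning

∧-trueˡ : ∀ {x y} → x ∧ y ≡ true → x ≡ true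
∧-trueˡ {true} _ = refl

∧-trueʳ : ∀ {x y} → x ∧ y ≡ true → y ≡ true
∧-trueʳ {true} e = e

T⇒≡true : ∀ {b} → T b → b ≡ true
T⇒≡true = Equivalence.to T-≡

≡true⇒T : ∀ {b} → b ≡ true → T b
≡true⇒T = Equivalence.from T-≡

<ᵇ-true : ∀ {a b} → a < b → (a <ᵇ b) ≡ true
<ᵇ-true a<b = T⇒≡true (<⇒<ᵇ a<b)

<ᵇ-false : ∀ {a b} → b ≤ a → (a <ᵇ b) ≡ false
<ᵇ-false {a} {b} b≤a with a <ᵇ b in eq
... | false = refl
... | true  = ⊥-elim (<⇒≱ (<ᵇ⇒< a b (≡true⇒T eq)) b≤a)

≤ᵇ-true : ∀ {a b} → a ≤ b → (a ≤ᵇ b) ≡ true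
≤ᵇ-true a≤b = T⇒≡true (≤⇒≤ᵇ a≤b)

≡ᵇ-refl : ∀ k → (k ≡ᵇ k) ≡ true
≡ᵇ-refl k = T⇒≡true (≡⇒≡ᵇ k k refl)

≡ᵇ-false : ∀ {a b} → a ≢ b → (a ≡ᵇ b) ≡ false
≡ᵇ-false {a} {b} a≢b with a ≡ᵇ b in eq
... | false = refl
... | true  = ⊥-elim (a≢b (≡ᵇ⇒≡ a b (≡true⇒T eq)))

≡ᵇ-true⇒≡ : ∀ {a b} → (a ≡ᵇ b) ≡ true → a ≡ b
≡ᵇ-true⇒≡ {a} {b} e = ≡ᵇ⇒≡ a b (≡true⇒T e)

AllAtLeast : ℕ → List ℕ → Set
AllAtLeast k = All (k ≤_)

AllAtLeast-weaken : ∀ {k} → ∀ {xs} → AllAtLeast (suc k) xs → AllAtLeast k xs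
AllAtLeast-weaken = All.map (λ k<x → ≤-trans (n≤1+n _) k<x)

record Triple : Set where
  constructor triple
  field
    row₁ row₂ column : List ℕ
open Triple

record TripleAtLeast (k : ℕ) (t : Triple) : Set where
  constructor atLeast
  field
    row₁-atLeast   : AllAtLeast k (row₁ t)
    row₂-atLeast   : AllAtLeast k (row₂ t)
    column-atLeast : AllAtLeast k (column t)

place : Step → ℕ → Triple → Triple
place U k (triple a b c) = triple (k ∷ a) b c
place D k (triple a b c) = triple a (k ∷ b) c
place F k (triple a b c) = triple a b (k ∷ c)

positions : ℕ → List Step → Triple
positions k []      = triple [] [] []
positions k (s ∷ w) = place s k (positions (suc k) w)

positions-atLeast : ∀ k w → TripleAtLeast k (positions k w)
positions-atLeast k []      = atLeast [] [] []
positions-atLeast k (U ∷ w) with positions (suc k) w | positions-atLeast (suc k) w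
... | triple a b c | atLeast p q r = atLeast (≤-refl ∷ AllAtLeast-weaken p) (AllAtLeast-weaken q) (AllAtLeast-weaken r)
positions-atLeast k (D ∷ w) with positions (suc k) w | positions-atLeast (suc k) w
... | triple a b c | atLeast p q r = atLeast (AllAtLeast-weaken p) (≤-refl ∷ AllAtLeast-weaken q) (AllAtLeast-weaken r)
positions-atLeast k (F ∷ w) with positions (suc k) w | positions-atLeast (suc k) w
... | triple a b c | atLeast p q r = atLeast (AllAtLeast-weaken p) (AllAtLeast-weaken q) (≤-refl ∷ AllAtLeast-weaken r)

startsBelow : List ℕ → List ℕ → Bool
startsBelow b       []      = true
startsBelow []      (c ∷ _) = false
startsBelow (b ∷ _) (c ∷ _) = b <ᵇ c

belowInc-cons-drop : ∀ h k a b → AllAtLeast (suc k) b → belowInc (k ∷ a) (drop h b) ≡ belowInc a (drop (suc h) b)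
belowInc-cons-drop h       k a []      _        = cong (belowInc (k ∷ a)) (drop-[] h)
belowInc-cons-drop zero    k a (x ∷ b) (p ∷ ps) = cong (_∧ belowInc a b) (<ᵇ-true p)
belowInc-cons-drop (suc h) k a (x ∷ b) (p ∷ ps) = belowInc-cons-drop h k a b ps

belowInc-cons : ∀ k a b → AllAtLeast (suc k) a → belowInc a (k ∷ b) ≡ false
belowInc-cons k []      b _       = refl
belowInc-cons k (x ∷ a) b (p ∷ _) = cong (_∧ belowInc a b) (<ᵇ-false (≤-trans (n≤1+n k) p))

startsBelow-cons-true : ∀ k b c → AllAtLeast (suc k) c → startsBelow (k ∷ b) c ≡ true
startsBelow-cons-true k b []      _       = refl
startsBelow-cons-true k b (x ∷ c) (p ∷ _) = <ᵇ-true p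

startsBelow-cons-false : ∀ k b c → AllAtLeast (suc k) b → startsBelow b (k ∷ c) ≡ false
startsBelow-cons-false k []      c _       = refl
startsBelow-cons-false k (x ∷ b) c (p ∷ _) = <ᵇ-false (≤-trans (n≤1+n k) p)

-- The first h D's of w are matched by U's read before w.
ballotFrom-positions : ∀ s h k w →
  ballotFrom s h w ≡ (belowInc (row₁ (positions k w)) (drop h (row₂ (positions k w))) ∧ (s ∨ startsBelow (row₂ (positions k w)) (column (positions k w))))
ballotFrom-positions s h k [] rewrite drop-[] {A = ℕ} h with s
... | true  = refl
... | false = refl
ballotFrom-positions s h k (U ∷ w) with positions (suc k) w | positions-atLeast (suc k) w | ballotFrom-positions s (suc h) (suc k) w
... | triple a b c | atLeast p q r | ih = trans ih (cong (_∧ (s ∨ startsBelow b c)) (sym (belowInc-cons-drop h k a b q)))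
ballotFrom-positions s zero k (D ∷ w) with positions (suc k) w | positions-atLeast (suc k) w
... | triple a b c | atLeast p q r = sym (cong (_∧ (s ∨ startsBelow (k ∷ b) c)) (belowInc-cons k a b p))
ballotFrom-positions true (suc h) k (D ∷ w) with positions (suc k) w | positions-atLeast (suc k) w | ballotFrom-positions true h (suc k) w
... | triple a b c | atLeast p q r | ih = ih
ballotFrom-positions false (suc h) k (D ∷ w) with positions (suc k) w | positions-atLeast (suc k) w | ballotFrom-positions true h (suc k) w
... | triple a b c | atLeast p q r | ih = trans ih (cong (belowInc a (drop h b) ∧_) (sym (startsBelow-cons-true k b c r)))
ballotFrom-positions false h k (F ∷ w) with positions (suc k) w | positions-atLeast (suc k) w
... | triple a b c | atLeast p q r = sym (trans (cong (belowInc a (drop h b) ∧_) (startsBelow-cons-false k b c q)) (∧-zeroʳ _))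
ballotFrom-positions true h k (F ∷ w) with positions (suc k) w | positions-atLeast (suc k) w | ballotFrom-positions true h (suc k) w
... | triple a b c | atLeast p q r | ih = ih

interval : ℕ → ℕ → List ℕ
interval k zero    = []
interval k (suc m) = k ∷ interval (suc k) m

InInterval : ℕ → ℕ → ℕ → Set
InInterval k m i = k ≤ i × i < k + m

InInterval-empty : ∀ {k i} → ¬ InInterval k 0 i
InInterval-empty {k} (k≤i , i<k+0) = <-irrefl refl (≤-trans i<k+0 (≤-trans (≤-reflexive (+-identityʳ k)) k≤i))

InInterval-start : ∀ k m → InInterval k (suc m) k
InInterval-start k m = ≤-refl , ≤-trans (s≤s (m≤m+n k m)) (≤-reflexive (sym (+-suc k m)))

InInterval-widen : ∀ {k m i} → InInterval (suc k) m i → InInterval k (suc m) i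
InInterval-widen {k} {m} (k<i , i<) = ≤-trans (n≤1+n k) k<i , ≤-trans i< (≤-reflexive (sym (+-suc k m)))

InInterval-narrow : ∀ {k m i} → InInterval k (suc m) i → k ≢ i → InInterval (suc k) m i
InInterval-narrow {k} {m} (k≤i , i<) k≢i = ≤∧≢⇒< k≤i k≢i , ≤-trans i< (≤-reflexive (+-suc k m))

All-interval : ∀ k m → All (InInterval k m) (interval k m)
All-interval k zero    = []
All-interval k (suc m) = InInterval-start k m ∷ All.map InInterval-widen (All-interval (suc k) m)

All-interval-lookup : ∀ {Q : ℕ → Set} k m → All Q (interval k m) → ∀ i → InInterval k m i → Q i
All-interval-lookup k zero    _          i i∈ = ⊥-elim (InInterval-empty i∈)
All-interval-lookup k (suc m) (qk ∷ qs) i i∈ with k ≟ i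
... | yes refl = qk
... | no  k≢i  = All-interval-lookup (suc k) m qs i (InInterval-narrow i∈ k≢i)

length-interval : ∀ k m → length (interval k m) ≡ m
length-interval k zero    = refl
length-interval k (suc m) = cong suc (length-interval (suc k) m)

applyUpTo≡interval : ∀ (f : ℕ → ℕ) k m → (∀ i → f i ≡ k + i) → applyUpTo f m ≡ interval k m
applyUpTo≡interval f k zero    f≗ = refl
applyUpTo≡interval f k (suc m) f≗ =
  cong₂ _∷_ (trans (f≗ 0) (+-identityʳ k)) (applyUpTo≡interval (λ i → f (suc i)) (suc k) m (λ i → trans (f≗ (suc i)) (+-suc k i)))

upTo≡interval : ∀ n → upTo n ≡ interval 0 n
upTo≡interval n = applyUpTo≡interval (λ i → i) 0 n (λ i → refl)

map-suc-interval : ∀ k m → map suc (interval k m) ≡ interval (suc k) m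
map-suc-interval k zero    = refl
map-suc-interval k (suc m) = cong (suc k ∷_) (map-suc-interval (suc k) m)

oneTo≡interval : ∀ n → oneTo n ≡ interval 1 n
oneTo≡interval n = trans (cong (map suc) (upTo≡interval n)) (map-suc-interval 0 n)

All-oneTo : ∀ n → All (InInterval 1 n) (oneTo n)
All-oneTo n = subst (All (InInterval 1 n)) (sym (oneTo≡interval n)) (All-interval 1 n)

_∈ᵇ_ : ℕ → List ℕ → Bool
i ∈ᵇ []       = false
i ∈ᵇ (x ∷ xs) = (x ≡ᵇ i) ∨ (i ∈ᵇ xs)

multiplicity : ℕ → List ℕ → ℕ
multiplicity i = countᵇ (λ x → x ≡ᵇ i)

∉ᵇ-atLeast : ∀ {k} xs → AllAtLeast (suc k) xs → (k ∈ᵇ xs) ≡ false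
∉ᵇ-atLeast []       []       = refl
∉ᵇ-atLeast {k} (x ∷ xs) (p ∷ ps) = trans (cong (_∨ (k ∈ᵇ xs)) (≡ᵇ-false (λ x≡k → <-irrefl (sym x≡k) p))) (∉ᵇ-atLeast xs ps)

∈ᵇ-cons-≢ : ∀ {k i} xs → k ≢ i → (i ∈ᵇ (k ∷ xs)) ≡ (i ∈ᵇ xs)
∈ᵇ-cons-≢ {i = i} xs k≢i = cong (_∨ (i ∈ᵇ xs)) (≡ᵇ-false k≢i)

∉ᵇ-++ : ∀ i xs ys → (i ∈ᵇ xs) ≡ false → (i ∈ᵇ ys) ≡ false → (i ∈ᵇ (xs ++ ys)) ≡ false
∉ᵇ-++ i []       ys _  e = e
∉ᵇ-++ i (x ∷ xs) ys e₁ e₂ with x ≡ᵇ i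
∉ᵇ-++ i (x ∷ xs) ys () e₂ | true
... | false = ∉ᵇ-++ i xs ys e₁ e₂

multiplicity-++ : ∀ i xs ys → multiplicity i (xs ++ ys) ≡ multiplicity i xs + multiplicity i ys
multiplicity-++ i []       ys = refl
multiplicity-++ i (x ∷ xs) ys with x ≡ᵇ i
... | true  = cong suc (multiplicity-++ i xs ys)
... | false = multiplicity-++ i xs ys

multiplicity-cons : ∀ i k xs → multiplicity i (k ∷ xs) ≡ iverson (k ≡ᵇ i) + multiplicity i xs
multiplicity-cons i k xs with k ≡ᵇ i
... | true  = refl
... | false = refl

∉ᵇ⇒multiplicity≡0 : ∀ i xs → (i ∈ᵇ xs) ≡ false → multiplicity i xs ≡ 0
∉ᵇ⇒multiplicity≡0 i []       e = refl
∉ᵇ⇒multiplicity≡0 i (x ∷ xs) e with x ≡ᵇ i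
∉ᵇ⇒multiplicity≡0 i (x ∷ xs) () | true
... | false = ∉ᵇ⇒multiplicity≡0 i xs e

∈ᵇ⇒multiplicity≥1 : ∀ i xs → (i ∈ᵇ xs) ≡ true → 1 ≤ multiplicity i xs
∈ᵇ⇒multiplicity≥1 i []       ()
∈ᵇ⇒multiplicity≥1 i (x ∷ xs) e with x ≡ᵇ i
... | true  = s≤s z≤n
... | false = ∈ᵇ⇒multiplicity≥1 i xs e

data ExactlyOne : Bool → Bool → Bool → Set where
  first  : ExactlyOne true false false
  second : ExactlyOne false true false
  third  : ExactlyOne false false true

exactlyOne : ∀ i a b c → multiplicity i a + (multiplicity i b + multiplicity i c) ≡ 1 →
             ExactlyOne (i ∈ᵇ a) (i ∈ᵇ b) (i ∈ᵇ c)
exactlyOne i a b c total≡1 with i ∈ᵇ a in ea | i ∈ᵇ b in eb | i ∈ᵇ c in ec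
... | true  | false | false = first
... | false | true  | false = second
... | false | false | true  = third
... | false | false | false = ⊥-elim (0≢1+n (trans (sym (cong₂ _+_ (m≡0 a ea) (cong₂ _+_ (m≡0 b eb) (m≡0 c ec)))) total≡1))
  where m≡0 = ∉ᵇ⇒multiplicity≡0 i
... | true  | true  | _     =
  ⊥-elim (2>total (+-mono-≤ (∈ᵇ⇒multiplicity≥1 i a ea) (≤-trans (∈ᵇ⇒multiplicity≥1 i b eb) (m≤m+n _ (multiplicity i c)))))
  where 2>total = λ 2≤ → <-irrefl refl (≤-trans 2≤ (≤-reflexive total≡1))
... | true  | false | true  =
  ⊥-elim (2>total (+-mono-≤ (∈ᵇ⇒multiplicity≥1 i a ea) (≤-trans (∈ᵇ⇒multiplicity≥1 i c ec) (m≤n+m _ (multiplicity i b)))))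
  where 2>total = λ 2≤ → <-irrefl refl (≤-trans 2≤ (≤-reflexive total≡1))
... | false | true  | true  =
  ⊥-elim (2>total (≤-trans (+-mono-≤ (∈ᵇ⇒multiplicity≥1 i b eb) (∈ᵇ⇒multiplicity≥1 i c ec)) (m≤n+m _ (multiplicity i a))))
  where 2>total = λ 2≤ → <-irrefl refl (≤-trans 2≤ (≤-reflexive total≡1))

strictlyInc-cons : ∀ k a → AllAtLeast (suc k) a → strictlyInc a ≡ true → strictlyInc (k ∷ a) ≡ true
strictlyInc-cons k []      _       _   = refl
strictlyInc-cons k (x ∷ a) (p ∷ _) inc = cong₂ _∧_ (<ᵇ-true p) inc

strictlyInc-tail : ∀ a r → strictlyInc (a ∷ r) ≡ true → strictlyInc r ≡ true
strictlyInc-tail a []      _   = refl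
strictlyInc-tail a (b ∷ r) inc = ∧-trueʳ inc

strictlyInc⇒atLeast : ∀ a r → strictlyInc (a ∷ r) ≡ true → AllAtLeast (suc a) r
strictlyInc⇒atLeast a []      _   = []
strictlyInc⇒atLeast a (b ∷ r) inc = a<b ∷ All.map (λ b<x → ≤-trans a<b (≤-trans (n≤1+n b) b<x)) (strictlyInc⇒atLeast b r (∧-trueʳ inc))
  where a<b = <ᵇ⇒< a b (≡true⇒T (∧-trueˡ inc))

record Increasing (t : Triple) : Set where
  constructor increasing
  field
    row₁-inc   : strictlyInc (row₁ t) ≡ true
    row₂-inc   : strictlyInc (row₂ t) ≡ true
    column-inc : strictlyInc (column t) ≡ true

positions-increasing : ∀ k w → Increasing (positions k w)
positions-increasing k []      = increasing refl refl refl
positions-increasing k (U ∷ w) with positions (suc k) w | positions-atLeast (suc k) w | positions-increasing (suc k) w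
... | triple a b c | atLeast p q r | increasing x y z = increasing (strictlyInc-cons k a p x) y z
positions-increasing k (D ∷ w) with positions (suc k) w | positions-atLeast (suc k) w | positions-increasing (suc k) w
... | triple a b c | atLeast p q r | increasing x y z = increasing x (strictlyInc-cons k b q y) z
positions-increasing k (F ∷ w) with positions (suc k) w | positions-atLeast (suc k) w | positions-increasing (suc k) w
... | triple a b c | atLeast p q r | increasing x y z = increasing x y (strictlyInc-cons k c r z)

entries : Triple → List ℕ
entries t = row₁ t ++ (row₂ t ++ column t)

positions-inInterval : ∀ k w → All (InInterval k (length w)) (entries (positions k w))
positions-inInterval k []      = []
positions-inInterval k (U ∷ w) with positions (suc k) w | positions-inInterval (suc k) w
... | triple a b c | ih = InInterval-start k (length w) ∷ All.map InInterval-widen ih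
positions-inInterval k (D ∷ w) with positions (suc k) w | positions-inInterval (suc k) w
... | triple a b c | ih =
  ++⁺ (All.map InInterval-widen (++⁻ˡ a ih)) (InInterval-start k (length w) ∷ All.map InInterval-widen (++⁻ʳ a ih))
positions-inInterval k (F ∷ w) with positions (suc k) w | positions-inInterval (suc k) w
... | triple a b c | ih =
  ++⁺ (All.map InInterval-widen (++⁻ˡ a ih))
      (++⁺ (All.map InInterval-widen (++⁻ˡ b (++⁻ʳ a ih))) (InInterval-start k (length w) ∷ All.map InInterval-widen (++⁻ʳ b (++⁻ʳ a ih))))

multiplicity-place : ∀ s k t i → multiplicity i (entries (place s k t)) ≡ iverson (k ≡ᵇ i) + multiplicity i (entries t)
multiplicity-place U k (triple a b c) i = multiplicity-cons i k (a ++ (b ++ c))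
multiplicity-place D k (triple a b c) i = begin
  m (a ++ ((k ∷ b) ++ c))         ≡⟨ multiplicity-++ i a _ ⟩
  m a + m (k ∷ (b ++ c))          ≡⟨ cong (m a +_) (multiplicity-cons i k (b ++ c)) ⟩
  m a + (δ + m (b ++ c))          ≡⟨ +-comm-middle (m a) δ _ ⟩
  δ + (m a + m (b ++ c))          ≡⟨ cong (δ +_) (sym (multiplicity-++ i a _)) ⟩
  δ + m (a ++ (b ++ c))           ∎
  where
  open ≡-Reasoning
  m = multiplicity i
  δ = iverson (k ≡ᵇ i)
  +-comm-middle : ∀ x y z → x + (y + z) ≡ y + (x + z)
  +-comm-middle = solve-∀
multiplicity-place F k (triple a b c) i = begin
  m (a ++ (b ++ (k ∷ c)))         ≡⟨ multiplicity-++ i a _ ⟩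
  m a + m (b ++ (k ∷ c))          ≡⟨ cong (m a +_) (multiplicity-++ i b _) ⟩
  m a + (m b + m (k ∷ c))         ≡⟨ cong (λ z → m a + (m b + z)) (multiplicity-cons i k c) ⟩
  m a + (m b + (δ + m c))         ≡⟨ bring-front (m a) (m b) δ (m c) ⟩
  δ + (m a + (m b + m c))         ≡⟨ cong (λ z → δ + (m a + z)) (sym (multiplicity-++ i b c)) ⟩
  δ + (m a + m (b ++ c))          ≡⟨ cong (δ +_) (sym (multiplicity-++ i a _)) ⟩
  δ + m (a ++ (b ++ c))           ∎
  where
  open ≡-Reasoning
  m = multiplicity i
  δ = iverson (k ≡ᵇ i)
  bring-front : ∀ x y z w → x + (y + (z + w)) ≡ z + (x + (y + w))
  bring-front = solve-∀

∉ᵇ-entries-positions : ∀ k w → (k ∈ᵇ entries (positions (suc k) w)) ≡ false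
∉ᵇ-entries-positions k w with positions (suc k) w | positions-atLeast (suc k) w
... | triple a b c | atLeast p q r = ∉ᵇ-++ k a _ (∉ᵇ-atLeast a p) (∉ᵇ-++ k b c (∉ᵇ-atLeast b q) (∉ᵇ-atLeast c r))

positions-once : ∀ k w i → InInterval k (length w) i → multiplicity i (entries (positions k w)) ≡ 1
positions-once k []      i i∈ = ⊥-elim (InInterval-empty i∈)
positions-once k (s ∷ w) i i∈ = trans (multiplicity-place s k (positions (suc k) w) i) (by-cases (k ≟ i))
  where
  by-cases : Dec (k ≡ i) → iverson (k ≡ᵇ i) + multiplicity i (entries (positions (suc k) w)) ≡ 1
  by-cases (yes refl) rewrite ≡ᵇ-refl k = cong suc (∉ᵇ⇒multiplicity≡0 k (entries (positions (suc k) w)) (∉ᵇ-entries-positions k w))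
  by-cases (no k≢i)   rewrite ≡ᵇ-false k≢i = positions-once (suc k) w i (InInterval-narrow i∈ k≢i)

-- The data of a standard tableau of shape (|row₁|, |row₂|, 1, …, 1) with entries 1, …, n.
record Standard (n : ℕ) (t : Triple) : Set where
  field
    inc        : Increasing t
    inInterval : All (InInterval 1 n) (entries t)
    once       : ∀ i → InInterval 1 n i → multiplicity i (entries t) ≡ 1
    belowInc₁₂ : belowInc (row₁ t) (row₂ t) ≡ true
    startsBelow₂₃ : startsBelow (row₂ t) (column t) ≡ true

positions-standard : ∀ w → ballotFrom false 0 w ≡ true → Standard (length w) (positions 1 w)
positions-standard w ballot = record
  { inc = positions-increasing 1 w
  ; inInterval = positions-inInterval 1 w
  ; once = positions-once 1 w
  ; belowInc₁₂ = ∧-trueˡ conditions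
  ; startsBelow₂₃ = ∧-trueʳ conditions
  }
  where conditions = trans (sym (ballotFrom-positions false 0 1 w)) ballot

sameStep : Step → Step → Bool
sameStep U U = true
sameStep F F = true
sameStep D D = true
sameStep _ _ = false

stepAt : Triple → ℕ → Step
stepAt t i = if i ∈ᵇ row₁ t then U else if i ∈ᵇ row₂ t then D else F

wordOf : ℕ → Triple → List Step
wordOf n t = map (stepAt t) (oneTo n)

length-wordOf : ∀ n t → length (wordOf n t) ≡ n
length-wordOf n t = trans (length-map (stepAt t) (oneTo n)) (trans (cong length (oneTo≡interval n)) (length-interval 1 n))

stepAt-place : ∀ s k t → TripleAtLeast (suc k) t → stepAt (place s k t) k ≡ s
stepAt-place U k (triple a b c) _ rewrite ≡ᵇ-refl k = refl
stepAt-place D k (triple a b c) (atLeast p q r) rewrite ∉ᵇ-atLeast a p | ≡ᵇ-refl k = refl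
stepAt-place F k (triple a b c) (atLeast p q r) rewrite ∉ᵇ-atLeast a p | ∉ᵇ-atLeast b q = refl

stepAt-place-≢ : ∀ s k t i → k ≢ i → stepAt (place s k t) i ≡ stepAt t i
stepAt-place-≢ U k (triple a b c) i k≢i rewrite ∈ᵇ-cons-≢ {k} {i} a k≢i = refl
stepAt-place-≢ D k (triple a b c) i k≢i rewrite ∈ᵇ-cons-≢ {k} {i} b k≢i = refl
stepAt-place-≢ F k (triple a b c) i k≢i = refl

map-cong-All : {P : A → Set} {f g : A → B} {xs : List A} → All P xs → (∀ x → P x → f x ≡ g x) → map f xs ≡ map g xs
map-cong-All []       f≗g = refl
map-cong-All (p ∷ ps) f≗g = cong₂ _∷_ (f≗g _ p) (map-cong-All ps f≗g)

stepAt-positions : ∀ k w → map (stepAt (positions k w)) (interval k (length w)) ≡ w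
stepAt-positions k []      = refl
stepAt-positions k (s ∷ w) = cong₂ _∷_
  (stepAt-place s k (positions (suc k) w) (positions-atLeast (suc k) w))
  (trans (map-cong-All (All-interval (suc k) (length w))
                       (λ i i∈ → stepAt-place-≢ s k (positions (suc k) w) i (λ k≡i → <-irrefl k≡i (proj₁ i∈))))
         (stepAt-positions (suc k) w))

wordOf-positions : ∀ w → wordOf (length w) (positions 1 w) ≡ w
wordOf-positions w = trans (cong (map (stepAt (positions 1 w))) (oneTo≡interval (length w))) (stepAt-positions 1 w)

positions-map : ∀ (f : ℕ → Step) k m → positions k (map f (interval k m))
  ≡ triple (filterᵇ (λ i → sameStep U (f i)) (interval k m)) (filterᵇ (λ i → sameStep D (f i)) (interval k m))
           (filterᵇ (λ i → sameStep F (f i)) (interval k m))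
positions-map f k zero    = refl
positions-map f k (suc m) with f k | positions-map f (suc k) m
... | U | ih = cong (place U k) ih
... | D | ih = cong (place D k) ih
... | F | ih = cong (place F k) ih

filterᵇ-congᴬ : {P : A → Set} {p q : A → Bool} {xs : List A} → All P xs → (∀ x → P x → p x ≡ q x) → filterᵇ p xs ≡ filterᵇ q xs
filterᵇ-congᴬ                 []                 p≗q = refl
filterᵇ-congᴬ {q = q} {x ∷ _} (px ∷ pxs) p≗q rewrite p≗q x px with q x
... | true  = cong (x ∷_) (filterᵇ-congᴬ pxs p≗q)
... | false = filterᵇ-congᴬ pxs p≗q

filterᵇ-reject : (p : A → Bool) {x : A} {xs : List A} → p x ≡ false → filterᵇ p (x ∷ xs) ≡ filterᵇ p xs
filterᵇ-reject p px≡false rewrite px≡false = refl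

filterᵇ-false : (xs : List A) → filterᵇ (λ _ → false) xs ≡ []
filterᵇ-false []       = refl
filterᵇ-false (x ∷ xs) = filterᵇ-false xs

All-InInterval-narrow : ∀ {k m xs} → AllAtLeast (suc k) xs → All (InInterval k (suc m)) xs → All (InInterval (suc k) m) xs
All-InInterval-narrow {k} {m} k<xs xs∈ = All.zipWith (λ (k<x , (_ , x<)) → k<x , ≤-trans x< (≤-reflexive (+-suc k m))) (k<xs , xs∈)

filterᵇ-∈ᵇ-interval : ∀ k m r → strictlyInc r ≡ true → All (InInterval k m) r → filterᵇ (_∈ᵇ r) (interval k m) ≡ r
filterᵇ-∈ᵇ-interval k zero    []      _   _          = refl
filterᵇ-∈ᵇ-interval k zero    (x ∷ r) _   (x∈ ∷ _)   = ⊥-elim (InInterval-empty x∈)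
filterᵇ-∈ᵇ-interval k (suc m) []      _   _          = filterᵇ-false (interval (suc k) m)
filterᵇ-∈ᵇ-interval k (suc m) (x ∷ r) inc (x∈ ∷ r∈) with k ≟ x
... | yes refl rewrite ≡ᵇ-refl k = cong (k ∷_) (begin
  filterᵇ (_∈ᵇ (k ∷ r)) (interval (suc k) m)
    ≡⟨ filterᵇ-congᴬ (All-interval (suc k) m) (λ i i∈ → ∈ᵇ-cons-≢ {k} {i} r (λ k≡i → <-irrefl k≡i (proj₁ i∈))) ⟩
  filterᵇ (_∈ᵇ r) (interval (suc k) m)
    ≡⟨ filterᵇ-∈ᵇ-interval (suc k) m r (strictlyInc-tail k r inc) (All-InInterval-narrow k<r r∈) ⟩
  r ∎)
  where
  open ≡-Reasoning
  k<r = strictlyInc⇒atLeast k r inc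
... | no k≢x = trans (filterᵇ-reject (_∈ᵇ (x ∷ r)) (∉ᵇ-atLeast (x ∷ r) k<x∷r))
  (filterᵇ-∈ᵇ-interval (suc k) m (x ∷ r) inc (All-InInterval-narrow k<x∷r (x∈ ∷ r∈)))
  where
  k<x = ≤∧≢⇒< (proj₁ x∈) k≢x
  k<x∷r = k<x ∷ All.map (λ x<y → ≤-trans k<x (≤-trans (n≤1+n _) x<y)) (strictlyInc⇒atLeast x r inc)

rowOf : Step → Triple → List ℕ
rowOf U = row₁
rowOf D = row₂
rowOf F = column

sameStep-stepAt : ∀ s t i → ExactlyOne (i ∈ᵇ row₁ t) (i ∈ᵇ row₂ t) (i ∈ᵇ column t) →
                  sameStep s (stepAt t i) ≡ (i ∈ᵇ rowOf s t)
sameStep-stepAt U t i one with i ∈ᵇ row₁ t | i ∈ᵇ row₂ t | i ∈ᵇ column t | one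
... | .true  | .false | .false | first  = refl
... | .false | .true  | .false | second = refl
... | .false | .false | .true  | third  = refl
sameStep-stepAt D t i one with i ∈ᵇ row₁ t | i ∈ᵇ row₂ t | i ∈ᵇ column t | one
... | .true  | .false | .false | first  = refl
... | .false | .true  | .false | second = refl
... | .false | .false | .true  | third  = refl
sameStep-stepAt F t i one with i ∈ᵇ row₁ t | i ∈ᵇ row₂ t | i ∈ᵇ column t | one
... | .true  | .false | .false | first  = refl
... | .false | .true  | .false | second = refl
... | .false | .false | .true  | third  = refl

rowOf-increasing : ∀ {t} → Increasing t → ∀ s → strictlyInc (rowOf s t) ≡ true
rowOf-increasing inc U = Increasing.row₁-inc inc
rowOf-increasing inc D = Increasing.row₂-inc inc
rowOf-increasing inc F = Increasing.column-inc inc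

rowOf-entries : ∀ {P : ℕ → Set} t → All P (entries t) → ∀ s → All P (rowOf s t)
rowOf-entries t all U = ++⁻ˡ (row₁ t) all
rowOf-entries t all D = ++⁻ˡ (row₂ t) (++⁻ʳ (row₁ t) all)
rowOf-entries t all F = ++⁻ʳ (row₂ t) (++⁻ʳ (row₁ t) all)

positions-wordOf : ∀ n t → Standard n t → positions 1 (wordOf n t) ≡ t
positions-wordOf n t std = begin
  positions 1 (map (stepAt t) (oneTo n))       ≡⟨ cong (λ is → positions 1 (map (stepAt t) is)) (oneTo≡interval n) ⟩
  positions 1 (map (stepAt t) (interval 1 n))  ≡⟨ positions-map (stepAt t) 1 n ⟩
  triple (select U) (select D) (select F)      ≡⟨ cong₂ (λ x y → triple x y (select F)) (select≡rowOf U) (select≡rowOf D) ⟩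
  triple (row₁ t) (row₂ t) (select F)          ≡⟨ cong (triple (row₁ t) (row₂ t)) (select≡rowOf F) ⟩
  t                                            ∎
  where
  open ≡-Reasoning
  open Standard std
  select : Step → List ℕ
  select s = filterᵇ (λ i → sameStep s (stepAt t i)) (interval 1 n)
  one : ∀ i → InInterval 1 n i → ExactlyOne (i ∈ᵇ row₁ t) (i ∈ᵇ row₂ t) (i ∈ᵇ column t)
  one i i∈ = exactlyOne i (row₁ t) (row₂ t) (column t)
    (trans (sym (trans (multiplicity-++ i (row₁ t) _) (cong (multiplicity i (row₁ t) +_) (multiplicity-++ i (row₂ t) (column t)))))
           (once i i∈))
  select≡rowOf : ∀ s → select s ≡ rowOf s t
  select≡rowOf s = trans (filterᵇ-congᴬ (All-interval 1 n) (λ i i∈ → sameStep-stepAt s t i (one i i∈)))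
                         (filterᵇ-∈ᵇ-interval 1 n (rowOf s t) (rowOf-increasing inc s) (rowOf-entries t inInterval s))

wordOf-ballot : ∀ n t → Standard n t → ballotFrom false 0 (wordOf n t) ≡ true
wordOf-ballot n t std = trans (ballotFrom-positions false 0 1 (wordOf n t))
  (subst (λ t′ → (belowInc (row₁ t′) (row₂ t′) ∧ startsBelow (row₂ t′) (column t′)) ≡ true) (sym (positions-wordOf n t std))
         (cong₂ _∧_ (Standard.belowInc₁₂ std) (Standard.startsBelow₂₃ std)))

consNonEmpty : List ℕ → List (List ℕ) → List (List ℕ)
consNonEmpty []      rows = rows
consNonEmpty (x ∷ r) rows = (x ∷ r) ∷ rows

singletons : List ℕ → List (List ℕ)
singletons = map (λ x → x ∷ [])

toFilling : Triple → List (List ℕ)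
toFilling (triple a b c) = consNonEmpty a (consNonEmpty b (singletons c))

fromFilling : List (List ℕ) → Triple
fromFilling []             = triple [] [] []
fromFilling (r ∷ [])       = triple r [] []
fromFilling (r ∷ s ∷ rows) = triple r s (concat rows)

data Shaped : Triple → Set where
  noRows  : Shaped (triple [] [] [])
  oneRow  : ∀ a₀ a → Shaped (triple (a₀ ∷ a) [] [])
  twoRows : ∀ a₀ a b₀ b c → Shaped (triple (a₀ ∷ a) (b₀ ∷ b) c)

shaped : ∀ t → belowInc (row₁ t) (row₂ t) ≡ true → startsBelow (row₂ t) (column t) ≡ true → Shaped t
shaped (triple []       []       [])      _ _  = noRows
shaped (triple []       []       (x ∷ c)) _ ()
shaped (triple []       (x ∷ b)  c)       () _
shaped (triple (a₀ ∷ a) []       [])      _ _  = oneRow a₀ a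
shaped (triple (a₀ ∷ a) []       (x ∷ c)) _ ()
shaped (triple (a₀ ∷ a) (b₀ ∷ b) c)       _ _  = twoRows a₀ a b₀ b c

Standard-shaped : ∀ {n t} → Standard n t → Shaped t
Standard-shaped {t = t} std = shaped t (Standard.belowInc₁₂ std) (Standard.startsBelow₂₃ std)

concat-singletons : ∀ c → concat (singletons c) ≡ c
concat-singletons []      = refl
concat-singletons (x ∷ c) = cong (x ∷_) (concat-singletons c)

concat-consNonEmpty : ∀ r rows → concat (consNonEmpty r rows) ≡ r ++ concat rows
concat-consNonEmpty []      rows = refl
concat-consNonEmpty (x ∷ r) rows = refl

concat-toFilling : ∀ t → concat (toFilling t) ≡ entries t
concat-toFilling (triple a b c) =
  trans (concat-consNonEmpty a _) (cong (a ++_) (trans (concat-consNonEmpty b _) (cong (b ++_) (concat-singletons c))))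

fromFilling-toFilling : ∀ {t} → Shaped t → fromFilling (toFilling t) ≡ t
fromFilling-toFilling noRows                = refl
fromFilling-toFilling (oneRow a₀ a)         = refl
fromFilling-toFilling (twoRows a₀ a b₀ b c) = cong (triple (a₀ ∷ a) (b₀ ∷ b)) (concat-singletons c)

allᵇ-strictlyInc-singletons : ∀ c → allᵇ strictlyInc (singletons c) ≡ true
allᵇ-strictlyInc-singletons []      = refl
allᵇ-strictlyInc-singletons (x ∷ c) = allᵇ-strictlyInc-singletons c

colsInc-singletons : ∀ c → colsInc (singletons c) ≡ strictlyInc c
colsInc-singletons []          = refl
colsInc-singletons (x ∷ [])    = refl
colsInc-singletons (x ∷ y ∷ c) = cong₂ _∧_ (∧-identityʳ (x <ᵇ y)) (colsInc-singletons (y ∷ c))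

colsInc-row-singletons : ∀ b₀ b c → colsInc ((b₀ ∷ b) ∷ singletons c) ≡ (startsBelow (b₀ ∷ b) c ∧ strictlyInc c)
colsInc-row-singletons b₀ b []      = refl
colsInc-row-singletons b₀ b (x ∷ c) = cong₂ _∧_ (∧-identityʳ (b₀ <ᵇ x)) (colsInc-singletons (x ∷ c))

-- The conditions of Standard that isSYT checks; isSYT does not bound the entries.
tableauConditions : ℕ → Triple → Bool
tableauConditions n t =
  allᵇ (λ i → multiplicity i (entries t) ≡ᵇ 1) (oneTo n) ∧
  (strictlyInc (row₁ t) ∧ (strictlyInc (row₂ t) ∧ (strictlyInc (column t) ∧
  (belowInc (row₁ t) (row₂ t) ∧ startsBelow (row₂ t) (column t)))))

∧-reorder : ∀ x y z p q → (x ∧ (y ∧ true)) ∧ (p ∧ (q ∧ z)) ≡ x ∧ (y ∧ (z ∧ (p ∧ q)))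
∧-reorder false y     z     p     q     = refl
∧-reorder true  false z     p     q     = refl
∧-reorder true  true  z     false q     = sym (∧-zeroʳ z)
∧-reorder true  true  z     true  false = sym (∧-zeroʳ z)
∧-reorder true  true  false true  true  = refl
∧-reorder true  true  true  true  true  = refl

isSYT-toFilling : ∀ n {t} → Shaped t → isSYT n (toFilling t) ≡ tableauConditions n t
isSYT-toFilling n noRows        = refl
isSYT-toFilling n (oneRow a₀ a) = cong (usesEachOnce n ((a₀ ∷ a) ∷ []) ∧_) (∧-identityʳ (strictlyInc (a₀ ∷ a) ∧ true))
isSYT-toFilling n (twoRows a₀ a b₀ b c) = cong₂ _∧_
  (cong (λ xs → allᵇ (λ i → multiplicity i xs ≡ᵇ 1) (oneTo n)) (concat-toFilling (triple (a₀ ∷ a) (b₀ ∷ b) c)))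
  (begin
    (R₁ ∧ (R₂ ∧ allᵇ strictlyInc (singletons c))) ∧ (belowInc (a₀ ∷ a) (b₀ ∷ b) ∧ colsInc ((b₀ ∷ b) ∷ singletons c))
      ≡⟨ cong₂ (λ x y → (R₁ ∧ (R₂ ∧ x)) ∧ (belowInc (a₀ ∷ a) (b₀ ∷ b) ∧ y)) (allᵇ-strictlyInc-singletons c) (colsInc-row-singletons b₀ b c) ⟩
    (R₁ ∧ (R₂ ∧ true)) ∧ (belowInc (a₀ ∷ a) (b₀ ∷ b) ∧ (startsBelow (b₀ ∷ b) c ∧ strictlyInc c))
      ≡⟨ ∧-reorder R₁ R₂ (strictlyInc c) (belowInc (a₀ ∷ a) (b₀ ∷ b)) (startsBelow (b₀ ∷ b) c) ⟩
    R₁ ∧ (R₂ ∧ (strictlyInc c ∧ (belowInc (a₀ ∷ a) (b₀ ∷ b) ∧ startsBelow (b₀ ∷ b) c))) ∎)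
  where
  open ≡-Reasoning
  R₁ = strictlyInc (a₀ ∷ a)
  R₂ = strictlyInc (b₀ ∷ b)

allᵇ-true : (p : A → Bool) {P : A → Set} {xs : List A} → All P xs → (∀ x → P x → p x ≡ true) → allᵇ p xs ≡ true
allᵇ-true p []         p-true = refl
allᵇ-true p (px ∷ pxs) p-true rewrite p-true _ px = allᵇ-true p pxs p-true

allᵇ-true⁻ : (p : A → Bool) (xs : List A) → allᵇ p xs ≡ true → All (λ x → p x ≡ true) xs
allᵇ-true⁻ p []       _ = []
allᵇ-true⁻ p (x ∷ xs) e = ∧-trueˡ e ∷ allᵇ-true⁻ p xs (∧-trueʳ e)

tableauConditions-standard : ∀ n t → Standard n t → tableauConditions n t ≡ true
tableauConditions-standard n t std = cong₂ _∧_
  (allᵇ-true _ (All-oneTo n) (λ i i∈ → cong (_≡ᵇ 1) (once i i∈)))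
  (cong₂ _∧_ row₁-inc (cong₂ _∧_ row₂-inc (cong₂ _∧_ column-inc (cong₂ _∧_ belowInc₁₂ startsBelow₂₃))))
  where
  open Standard std
  open Increasing inc

standard-tableauConditions : ∀ n t → All (InInterval 1 n) (entries t) → tableauConditions n t ≡ true → Standard n t
standard-tableauConditions n t entries∈ holds = record
  { inc = increasing (∧-trueˡ {I₁} r₁) (∧-trueˡ {I₂} r₂) (∧-trueˡ {I₃} r₃)
  ; inInterval = entries∈
  ; once = λ i i∈ → ≡ᵇ-true⇒≡ (All-interval-lookup 1 n (subst (All _) (oneTo≡interval n) (allᵇ-true⁻ _ (oneTo n) (∧-trueˡ {E} holds))) i i∈)
  ; belowInc₁₂ = ∧-trueˡ {below} r₄
  ; startsBelow₂₃ = ∧-trueʳ {below} r₄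
  }
  where
  E = allᵇ (λ i → multiplicity i (entries t) ≡ᵇ 1) (oneTo n)
  I₁ = strictlyInc (row₁ t)
  I₂ = strictlyInc (row₂ t)
  I₃ = strictlyInc (column t)
  below = belowInc (row₁ t) (row₂ t)
  r₁ = ∧-trueʳ {E} holds
  r₂ = ∧-trueʳ {I₁} r₁
  r₃ = ∧-trueʳ {I₂} r₂
  r₄ = ∧-trueʳ {I₃} r₃

weaklyDecPos-positive : ∀ μ → weaklyDecPos μ ≡ true → All (1 ≤_) μ
weaklyDecPos-positive []          _   = []
weaklyDecPos-positive (a ∷ [])    dec = ≤ᵇ⇒≤ 1 a (≡true⇒T dec) ∷ []
weaklyDecPos-positive (a ∷ b ∷ μ) dec with weaklyDecPos-positive (b ∷ μ) (∧-trueʳ dec)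
... | 1≤b ∷ rest = ≤-trans 1≤b (≤ᵇ⇒≤ b a (≡true⇒T (∧-trueˡ dec))) ∷ 1≤b ∷ rest

weaklyDecPos-bounded : ∀ c μ → weaklyDecPos (c ∷ μ) ≡ true → All (_≤ c) μ
weaklyDecPos-bounded c []      _   = []
weaklyDecPos-bounded c (b ∷ μ) dec = b≤c ∷ All.map (λ x≤b → ≤-trans x≤b b≤c) (weaklyDecPos-bounded b μ (∧-trueʳ dec))
  where b≤c = ≤ᵇ⇒≤ b c (≡true⇒T (∧-trueˡ dec))

weaklyDecPos-tail : ∀ a μ → weaklyDecPos (a ∷ μ) ≡ true → weaklyDecPos μ ≡ true
weaklyDecPos-tail a []      _   = refl
weaklyDecPos-tail a (b ∷ μ) dec = ∧-trueʳ dec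

weaklyDecPos-ones : ∀ c μ → weaklyDecPos (c ∷ μ) ≡ true → c ≤ 1 → All (_≡ 1) (c ∷ μ)
weaklyDecPos-ones c μ dec c≤1 =
  All.zipWith (λ (1≤x , x≤1) → ≤-antisym x≤1 1≤x)
    (weaklyDecPos-positive (c ∷ μ) dec , c≤1 ∷ All.map (λ x≤c → ≤-trans x≤c c≤1) (weaklyDecPos-bounded c μ dec))

singletons-concat : ∀ rows → All (λ r → length r ≡ 1) rows → singletons (concat rows) ≡ rows
singletons-concat []                  []       = refl
singletons-concat ((x ∷ []) ∷ rows)   (_ ∷ ps) = cong ((x ∷ []) ∷_) (singletons-concat rows ps)

toFilling-fromFilling : ∀ x → weaklyDecPos (map length x) ≡ true → (part 2 (map length x) ≤ᵇ 1) ≡ true →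
                        Shaped (fromFilling x) × toFilling (fromFilling x) ≡ x
toFilling-fromFilling []                  _   _     = noRows , refl
toFilling-fromFilling ([] ∷ [])           ()  _
toFilling-fromFilling ((r₀ ∷ r) ∷ [])      _   _     = oneRow r₀ r , refl
toFilling-fromFilling (r ∷ s ∷ rows)      dec p₃ with weaklyDecPos-positive (map length (r ∷ s ∷ rows)) dec
toFilling-fromFilling ([] ∷ s ∷ rows)       dec p₃ | () ∷ _
toFilling-fromFilling ((r₀ ∷ r) ∷ [] ∷ rows) dec p₃ | _ ∷ () ∷ _
toFilling-fromFilling ((r₀ ∷ r) ∷ (s₀ ∷ s) ∷ rows) dec p₃ | _ =
  twoRows r₀ r s₀ s (concat rows) , cong (λ z → (r₀ ∷ r) ∷ (s₀ ∷ s) ∷ z) (singletons-concat rows (lengths-one rows dec p₃))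
  where
  lengths-one : ∀ rows → weaklyDecPos (map length ((r₀ ∷ r) ∷ (s₀ ∷ s) ∷ rows)) ≡ true →
                (part 2 (map length ((r₀ ∷ r) ∷ (s₀ ∷ s) ∷ rows)) ≤ᵇ 1) ≡ true → All (λ q → length q ≡ 1) rows
  lengths-one []       _   _  = []
  lengths-one (q ∷ qs) dec p₃ = map⁻ (weaklyDecPos-ones (length q) (map length qs)
    (weaklyDecPos-tail (length (s₀ ∷ s)) (map length (q ∷ qs)) (weaklyDecPos-tail (length (r₀ ∷ r)) (map length ((s₀ ∷ s) ∷ q ∷ qs)) dec)) (≤ᵇ⇒≤ (length q) 1 (≡true⇒T p₃)))

record KroneckerDelta (A : Set) : Set where
  field
    δ      : A → A → ℕ
    δ-refl : ∀ a → δ a a ≡ 1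
    δ-dec  : ∀ a b → a ≡ b ⊎ δ a b ≡ 0
open KroneckerDelta

δℕ : ℕ → ℕ → ℕ
δℕ a b = iverson (a ≡ᵇ b)

deltaℕ : KroneckerDelta ℕ
deltaℕ = record { δ = δℕ ; δ-refl = λ a → cong iverson (≡ᵇ-refl a) ; δ-dec = dec }
  where
  dec : ∀ a b → a ≡ b ⊎ δℕ a b ≡ 0
  dec a b with a ≟ b
  ... | yes a≡b = inj₁ a≡b
  ... | no  a≢b = inj₂ (cong iverson (≡ᵇ-false a≢b))

deltaStep : KroneckerDelta Step
deltaStep = record { δ = λ s s′ → iverson (sameStep s s′) ; δ-refl = refl′ ; δ-dec = dec }
  where
  refl′ : ∀ s → iverson (sameStep s s) ≡ 1
  refl′ U = refl
  refl′ F = refl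
  refl′ D = refl
  dec : ∀ s s′ → s ≡ s′ ⊎ iverson (sameStep s s′) ≡ 0
  dec U U = inj₁ refl
  dec U F = inj₂ refl
  dec U D = inj₂ refl
  dec F U = inj₂ refl
  dec F F = inj₁ refl
  dec F D = inj₂ refl
  dec D U = inj₂ refl
  dec D F = inj₂ refl
  dec D D = inj₁ refl

δList : (A → A → ℕ) → List A → List A → ℕ
δList δ₀ []       []       = 1
δList δ₀ []       (y ∷ ys) = 0
δList δ₀ (x ∷ xs) []       = 0
δList δ₀ (x ∷ xs) (y ∷ ys) = δ₀ x y * δList δ₀ xs ys

deltaList : KroneckerDelta A → KroneckerDelta (List A)
deltaList Δ = record { δ = δList (δ Δ) ; δ-refl = refl′ ; δ-dec = dec }
  where
  refl′ : ∀ xs → δList (δ Δ) xs xs ≡ 1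
  refl′ []       = refl
  refl′ (x ∷ xs) rewrite δ-refl Δ x | refl′ xs = refl
  dec : ∀ xs ys → xs ≡ ys ⊎ δList (δ Δ) xs ys ≡ 0
  dec []       []       = inj₁ refl
  dec []       (y ∷ ys) = inj₂ refl
  dec (x ∷ xs) []       = inj₂ refl
  dec (x ∷ xs) (y ∷ ys) with δ-dec Δ x y | dec xs ys
  ... | inj₁ refl | inj₁ refl = inj₁ refl
  ... | inj₁ refl | inj₂ z    = inj₂ (trans (cong (δ Δ x x *_) z) (*-zeroʳ (δ Δ x x)))
  ... | inj₂ z    | _         = inj₂ (cong (_* δList (δ Δ) xs ys) z)

∑-δℕ-interval-below : ∀ i k m → i < k → ∑ (interval k m) (δℕ i) ≡ 0
∑-δℕ-interval-below i k zero    _   = refl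
∑-δℕ-interval-below i k (suc m) i<k =
  cong₂ _+_ (cong iverson (≡ᵇ-false (λ i≡k → <-irrefl i≡k i<k))) (∑-δℕ-interval-below i (suc k) m (≤-trans i<k (n≤1+n k)))

∑-δℕ-interval : ∀ i k m → InInterval k m i → ∑ (interval k m) (δℕ i) ≡ 1
∑-δℕ-interval i k zero    i∈ = ⊥-elim (InInterval-empty i∈)
∑-δℕ-interval i k (suc m) i∈ with k ≟ i
... | yes refl = cong₂ _+_ (cong iverson (≡ᵇ-refl i)) (∑-δℕ-interval-below i (suc i) m ≤-refl)
... | no  k≢i  = cong₂ _+_ (cong iverson (≡ᵇ-false (λ i≡k → k≢i (sym i≡k)))) (∑-δℕ-interval i (suc k) m (InInterval-narrow i∈ k≢i))

∑-δℕ-oneTo : ∀ n i → InInterval 1 n i → ∑ (oneTo n) (δℕ i) ≡ 1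
∑-δℕ-oneTo n i i∈ = trans (cong (λ is → ∑ is (δℕ i)) (oneTo≡interval n)) (∑-δℕ-interval i 1 n i∈)

length≡∑multiplicity : ∀ k m xs → All (InInterval k m) xs → length xs ≡ ∑ (interval k m) (λ i → multiplicity i xs)
length≡∑multiplicity k m []       []         = sym (∑-zero (interval k m))
length≡∑multiplicity k m (x ∷ xs) (x∈ ∷ xs∈) = begin
  suc (length xs)
    ≡⟨ cong₂ _+_ (sym (∑-δℕ-interval x k m x∈)) (length≡∑multiplicity k m xs xs∈) ⟩
  ∑ (interval k m) (δℕ x) + ∑ (interval k m) (λ i → multiplicity i xs)
    ≡⟨ sym (∑-+ (interval k m) (δℕ x) _) ⟩
  ∑ (interval k m) (λ i → δℕ x i + multiplicity i xs)
    ≡⟨ ∑-cong (interval k m) (λ i → sym (multiplicity-cons i x xs)) ⟩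
  ∑ (interval k m) (λ i → multiplicity i (x ∷ xs)) ∎
  where open ≡-Reasoning

length-permutation-interval : ∀ n xs → All (InInterval 1 n) xs → (∀ i → InInterval 1 n i → multiplicity i xs ≡ 1) → length xs ≡ n
length-permutation-interval n xs xs∈ once = begin
  length xs                                ≡⟨ length≡∑multiplicity 1 n xs xs∈ ⟩
  ∑ (interval 1 n) (λ i → multiplicity i xs) ≡⟨ ∑-congᴬ (All-interval 1 n) once ⟩
  ∑ (interval 1 n) (λ _ → 1)               ≡⟨ ∑-one (interval 1 n) ⟩
  length (interval 1 n)                    ≡⟨ length-interval 1 n ⟩
  n                                        ∎
  where open ≡-Reasoning

sum-map-length : ∀ (rows : List (List ℕ)) → sum (map length rows) ≡ length (concat rows)
sum-map-length []         = refl
sum-map-length (r ∷ rows) = trans (cong (length r +_) (sum-map-length rows)) (sym (length-++ r))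

belowInc⇒length≤ : ∀ a b → belowInc a b ≡ true → length b ≤ length a
belowInc⇒length≤ a       []      _   = z≤n
belowInc⇒length≤ []      (x ∷ b) ()
belowInc⇒length≤ (y ∷ a) (x ∷ b) inc = s≤s (belowInc⇒length≤ a b (∧-trueʳ {y <ᵇ x} inc))

map-length-singletons : ∀ c → map length (singletons c) ≡ map (λ _ → 1) c
map-length-singletons []      = refl
map-length-singletons (x ∷ c) = cong (1 ∷_) (map-length-singletons c)

weaklyDecPos-ones⁺ : ∀ a (c : List ℕ) → weaklyDecPos (suc a ∷ map (λ _ → 1) c) ≡ true
weaklyDecPos-ones⁺ a []          = refl
weaklyDecPos-ones⁺ a (x ∷ [])    = refl
weaklyDecPos-ones⁺ a (x ∷ y ∷ c) = weaklyDecPos-ones⁺ 0 (y ∷ c)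

toFilling-shape : ∀ {t} → Shaped t → belowInc (row₁ t) (row₂ t) ≡ true →
  weaklyDecPos (map length (toFilling t)) ≡ true × (part 2 (map length (toFilling t)) ≤ᵇ 1) ≡ true
toFilling-shape noRows                _   = refl , refl
toFilling-shape (oneRow a₀ a)         _   = refl , refl
toFilling-shape (twoRows a₀ a b₀ b c) inc rewrite map-length-singletons c =
  cong₂ _∧_ (≤ᵇ-true (belowInc⇒length≤ (a₀ ∷ a) (b₀ ∷ b) inc)) (weaklyDecPos-ones⁺ (length b) c) , third-part c
  where
  third-part : ∀ c → (part 2 (suc (length a) ∷ suc (length b) ∷ map (λ _ → 1) c) ≤ᵇ 1) ≡ true
  third-part []      = refl
  third-part (x ∷ c) = refl

toFilling-partition : ∀ n t → Standard n t →
  isPartitionOf n (map length (toFilling t)) ≡ true × (part 2 (map length (toFilling t)) ≤ᵇ 1) ≡ true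
toFilling-partition n t std = cong₂ _∧_ (proj₁ shape) (T⇒≡true (≡⇒≡ᵇ _ n size)) , proj₂ shape
  where
  shape = toFilling-shape (Standard-shaped std) (Standard.belowInc₁₂ std)
  size : sum (map length (toFilling t)) ≡ n
  size = trans (sum-map-length (toFilling t)) (trans (cong length (concat-toFilling t))
           (length-permutation-interval n (entries t) (Standard.inInterval std) (Standard.once std)))

toFilling-entries : ∀ {P : ℕ → Set} {t} → Shaped t → All P (entries t) → All (All P) (toFilling t)
toFilling-entries noRows                _   = []
toFilling-entries (oneRow a₀ a)         all = ++⁻ˡ (a₀ ∷ a) all ∷ []
toFilling-entries (twoRows a₀ a b₀ b c) all =
  ++⁻ˡ (a₀ ∷ a) all ∷ ++⁻ˡ (b₀ ∷ b) (++⁻ʳ (a₀ ∷ a) all) ∷ map⁺ (All.map (_∷ []) (++⁻ʳ (b₀ ∷ b) (++⁻ʳ (a₀ ∷ a) all)))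

∑-δList-prefixed : (δ₀ : A → A → ℕ) (xs : List A) (M : List (List A)) (a : A) (w : List A) →
  ∑ (concatMap (λ x → map (x ∷_) M) xs) (δList δ₀ (a ∷ w)) ≡ ∑ xs (δ₀ a) * ∑ M (δList δ₀ w)
∑-δList-prefixed δ₀ xs M a w = begin
  ∑ (concatMap (λ x → map (x ∷_) M) xs) (δList δ₀ (a ∷ w)) ≡⟨ ∑-concatMap xs _ _ ⟩
  ∑ xs (λ x → ∑ (map (x ∷_) M) (δList δ₀ (a ∷ w)))      ≡⟨ ∑-cong xs (λ x → ∑-map M (x ∷_) _) ⟩
  ∑ xs (λ x → ∑ M (λ v → δ₀ a x * δList δ₀ w v))        ≡⟨ ∑-cong xs (λ x → ∑-*ˡ M (δ₀ a x) (δList δ₀ w)) ⟩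
  ∑ xs (λ x → δ₀ a x * ∑ M (δList δ₀ w))                ≡⟨ ∑-*ʳ xs _ (δ₀ a) ⟩
  ∑ xs (δ₀ a) * ∑ M (δList δ₀ w)                        ∎
  where open ≡-Reasoning

∑-δList-prefixed-[] : (δ₀ : A → A → ℕ) (xs : List A) (M : List (List A)) →
  ∑ (concatMap (λ x → map (x ∷_) M) xs) (δList δ₀ []) ≡ 0
∑-δList-prefixed-[] δ₀ xs M =
  trans (∑-concatMap xs _ _) (trans (∑-cong xs (λ x → trans (∑-map M (x ∷_) _) (∑-zero M))) (∑-zero xs))

∑-δList-listsOf : (δ₀ : A → A → ℕ) (xs : List A) → ∀ k w → All (λ a → ∑ xs (δ₀ a) ≡ 1) w →
                  ∑ (listsOf k xs) (δList δ₀ w) ≡ δℕ (length w) k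
∑-δList-listsOf δ₀ xs zero    []      _        = refl
∑-δList-listsOf δ₀ xs zero    (a ∷ w) _        = refl
∑-δList-listsOf δ₀ xs (suc k) []      _        = ∑-δList-prefixed-[] δ₀ xs (listsOf k xs)
∑-δList-listsOf δ₀ xs (suc k) (a ∷ w) (p ∷ ps) =
  trans (∑-δList-prefixed δ₀ xs (listsOf k xs) a w) (trans (cong₂ _*_ p (∑-δList-listsOf δ₀ xs k w ps)) (+-identityʳ _))

∑-δList-fillings : ∀ n λs t → All (All (InInterval 1 n)) t →
                   ∑ (fillings n λs) (δList (δList δℕ) t) ≡ δList δℕ (map length t) λs
∑-δList-fillings n []       []      _          = refl
∑-δList-fillings n []       (r ∷ t) _          = refl
∑-δList-fillings n (a ∷ λs) []      _          = ∑-δList-prefixed-[] (δList δℕ) (listsOf a (oneTo n)) (fillings n λs)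
∑-δList-fillings n (a ∷ λs) (r ∷ t) (r∈ ∷ t∈) =
  trans (∑-δList-prefixed (δList δℕ) (listsOf a (oneTo n)) (fillings n λs) r t)
        (cong₂ _*_ (∑-δList-listsOf δℕ (oneTo n) a r (All.map (λ {i} → ∑-δℕ-oneTo n i) r∈)) (∑-δList-fillings n λs t t∈))

∑-δ-filterᵇ : (Δ : KroneckerDelta A) (p : A → Bool) (xs : List A) (a : A) → p a ≡ true →
              ∑ (filterᵇ p xs) (δ Δ a) ≡ ∑ xs (δ Δ a)
∑-δ-filterᵇ Δ p xs a pa = trans (∑-filterᵇ xs p _) (∑-cong xs kept)
  where
  kept : ∀ x → (if p x then δ Δ a x else 0) ≡ δ Δ a x
  kept x with δ-dec Δ a x
  ... | inj₁ refl rewrite pa = refl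
  ... | inj₂ δ≡0 with p x
  ...   | true  = refl
  ...   | false = sym δ≡0

All-≤-sum : ∀ μ → All (_≤ sum μ) μ
All-≤-sum []      = []
All-≤-sum (a ∷ μ) = m≤m+n a (sum μ) ∷ All.map (λ x≤ → ≤-trans x≤ (m≤n+m (sum μ) a)) (All-≤-sum μ)

length≤sum : ∀ μ → All (1 ≤_) μ → length μ ≤ sum μ
length≤sum []      []         = z≤n
length≤sum (a ∷ μ) (1≤a ∷ ps) = +-mono-≤ 1≤a (length≤sum μ ps)

partition-bounds : ∀ n μ → isPartitionOf n μ ≡ true → All (InInterval 1 n) μ × length μ ≤ n
partition-bounds n μ isPart =
  All.zipWith (λ (1≤x , x≤n) → 1≤x , s≤s x≤n) (positive , subst (λ s → All (_≤ s) μ) size (All-≤-sum μ)) ,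
  subst (length μ ≤_) size (length≤sum μ positive)
  where
  positive = weaklyDecPos-positive μ (∧-trueˡ isPart)
  size : sum μ ≡ n
  size = ≡ᵇ-true⇒≡ (∧-trueʳ {weaklyDecPos μ} isPart)

shapes : ℕ → List (List ℕ)
shapes n = filterᵇ (λ λs → part 2 λs ≤ᵇ 1) (partitions n)

tableauFillings : ℕ → List (List (List ℕ))
tableauFillings n = concatMap (fillings n) (shapes n)

∑-δ-candidateParts : ∀ n μ → isPartitionOf n μ ≡ true → ∑ (candidateParts n) (δList δℕ μ) ≡ 1
∑-δ-candidateParts n μ isPart = begin
  ∑ (candidateParts n) (δList δℕ μ)
    ≡⟨ ∑-concatMap (upTo (suc n)) (λ k → listsOf k (oneTo n)) (δList δℕ μ) ⟩
  ∑ (upTo (suc n)) (λ k → ∑ (listsOf k (oneTo n)) (δList δℕ μ))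
    ≡⟨ ∑-cong (upTo (suc n)) (λ k → ∑-δList-listsOf δℕ (oneTo n) k μ (All.map (λ {i} → ∑-δℕ-oneTo n i) (proj₁ bounds))) ⟩
  ∑ (upTo (suc n)) (δℕ (length μ))
    ≡⟨ cong (λ ks → ∑ ks (δℕ (length μ))) (upTo≡interval (suc n)) ⟩
  ∑ (interval 0 (suc n)) (δℕ (length μ))
    ≡⟨ ∑-δℕ-interval (length μ) 0 (suc n) (z≤n , s≤s (proj₂ bounds)) ⟩
  1 ∎
  where
  open ≡-Reasoning
  bounds = partition-bounds n μ isPart

∑-δ-tableauFillings : ∀ n t → All (All (InInterval 1 n)) t →
  isPartitionOf n (map length t) ≡ true → (part 2 (map length t) ≤ᵇ 1) ≡ true →
  ∑ (tableauFillings n) (δList (δList δℕ) t) ≡ 1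
∑-δ-tableauFillings n t t∈ isPart third≤1 = begin
  ∑ (tableauFillings n) (δList (δList δℕ) t)
    ≡⟨ ∑-concatMap (shapes n) (fillings n) _ ⟩
  ∑ (shapes n) (λ μ → ∑ (fillings n μ) (δList (δList δℕ) t))
    ≡⟨ ∑-cong (shapes n) (λ μ → ∑-δList-fillings n μ t t∈) ⟩
  ∑ (shapes n) (δList δℕ (map length t))
    ≡⟨ ∑-δ-filterᵇ (deltaList deltaℕ) (λ λs → part 2 λs ≤ᵇ 1) (partitions n) (map length t) third≤1 ⟩
  ∑ (partitions n) (δList δℕ (map length t))
    ≡⟨ ∑-δ-filterᵇ (deltaList deltaℕ) (isPartitionOf n) (candidateParts n) (map length t) isPart ⟩
  ∑ (candidateParts n) (δList δℕ (map length t))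
    ≡⟨ ∑-δ-candidateParts n (map length t) isPart ⟩
  1 ∎
  where open ≡-Reasoning

record ShapedFilling (n : ℕ) (x : List (List ℕ)) : Set where
  field
    entries∈    : All (All (InInterval 1 n)) x
    partition   : isPartitionOf n (map length x) ≡ true
    thirdPart≤1 : (part 2 (map length x) ≤ᵇ 1) ≡ true

standard-shapedFilling : ∀ n t → Standard n t → ShapedFilling n (toFilling t)
standard-shapedFilling n t std = record
  { entries∈ = toFilling-entries (Standard-shaped std) (Standard.inInterval std)
  ; partition = proj₁ (toFilling-partition n t std)
  ; thirdPart≤1 = proj₂ (toFilling-partition n t std)
  }

standard-isSYT : ∀ n t → Standard n t → isSYT n (toFilling t) ≡ true
standard-isSYT n t std = trans (isSYT-toFilling n (Standard-shaped std)) (tableauConditions-standard n t std)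

isSYT-standard : ∀ n x → ShapedFilling n x → isSYT n x ≡ true → Standard n (fromFilling x) × toFilling (fromFilling x) ≡ x
isSYT-standard n x filling syt = standard , roundTrip
  where
  open ShapedFilling filling
  shape×roundTrip = toFilling-fromFilling x (∧-trueˡ partition) thirdPart≤1
  roundTrip = proj₂ shape×roundTrip
  standard = standard-tableauConditions n (fromFilling x)
    (subst (All (InInterval 1 n)) (concat-toFilling (fromFilling x)) (concat⁺ (subst (All (All (InInterval 1 n))) (sym roundTrip) entries∈)))
    (trans (sym (isSYT-toFilling n (proj₁ shape×roundTrip))) (subst (λ y → isSYT n y ≡ true) (sym roundTrip) syt))

All-concatMap : {P : A → Set} {Q : B → Set} (f : A → List B) {xs : List A} → All P xs → (∀ x → P x → All Q (f x)) → All Q (concatMap f xs)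
All-concatMap f pxs q = concat⁺ (map⁺ (All.map (λ {x} px → q x px) pxs))

All-listsOf : {Q : A → Set} (xs : List A) → All Q xs → ∀ k → All (λ w → length w ≡ k × All Q w) (listsOf k xs)
All-listsOf xs qs zero    = (refl , []) ∷ []
All-listsOf xs qs (suc k) = All-concatMap (λ x → map (x ∷_) (listsOf k xs)) qs
  (λ x qx → map⁺ (All.map (λ (len , qw) → cong suc len , qx ∷ qw) (All-listsOf xs qs k)))

All-fillings : ∀ n λs → All (λ t → map length t ≡ λs × All (All (InInterval 1 n)) t) (fillings n λs)
All-fillings n []       = (refl , []) ∷ []
All-fillings n (a ∷ λs) = All-concatMap (λ r → map (r ∷_) (fillings n λs)) (All-listsOf (oneTo n) (All-oneTo n) a)
  (λ r (len , r∈) → map⁺ (All.map (λ (lens , t∈) → cong₂ _∷_ len lens , r∈ ∷ t∈) (All-fillings n λs)))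

All-filterᵇ : (p : A → Bool) (xs : List A) → All (λ x → p x ≡ true) (filterᵇ p xs)
All-filterᵇ p xs = All.map T⇒≡true (all-filter (λ x → T? (p x)) xs)

All-tableauFillings : ∀ n → All (ShapedFilling n) (tableauFillings n)
All-tableauFillings n = All-concatMap (fillings n)
  (All.zip (filter⁺ (λ μ → T? (part 2 μ ≤ᵇ 1)) (All-filterᵇ (isPartitionOf n) (candidateParts n)) ,
            All-filterᵇ (λ μ → part 2 μ ≤ᵇ 1) (partitions n)))
  (λ μ (isPart , third≤1) → All.map (λ { {x} (lens , x∈) → record
       { entries∈ = x∈
       ; partition = subst (λ μ′ → isPartitionOf n μ′ ≡ true) (sym lens) isPart
       ; thirdPart≤1 = subst (λ μ′ → (part 2 μ′ ≤ᵇ 1) ≡ true) (sym lens) third≤1 } })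
     (All-fillings n μ))

S21≡∑isSYT : ∀ n → S21 n ≡ ∑ (tableauFillings n) (λ x → iverson (isSYT n x))
S21≡∑isSYT n = begin
  S21 n
    ≡⟨ sum-map≡∑ (shapes n) fˡ ⟩
  ∑ (shapes n) fˡ
    ≡⟨ ∑-congᴬ (filter⁺ (λ μ → T? (part 2 μ ≤ᵇ 1)) (All-filterᵇ (isPartitionOf n) (candidateParts n)))
               (λ μ isPart → trans (cong (λ m → countᵇ (isSYT m) (fillings m μ)) (≡ᵇ-true⇒≡ (∧-trueʳ {weaklyDecPos μ} isPart)))
                                   (countᵇ≡∑ (isSYT n) (fillings n μ))) ⟩
  ∑ (shapes n) (λ μ → ∑ (fillings n μ) (λ x → iverson (isSYT n x)))
    ≡⟨ sym (∑-concatMap (shapes n) (fillings n) _) ⟩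
  ∑ (tableauFillings n) (λ x → iverson (isSYT n x)) ∎
  where open ≡-Reasoning

-- Counting along a bijection

Transfers : {X Y : Set} → KroneckerDelta Y → List Y → (X → Bool) → (Y → Bool) → (X → Y) → (Y → X) → X → Set
Transfers ΔY ys p q f g x = p x ≡ true → q (f x) ≡ true × g (f x) ≡ x × ∑ ys (δ ΔY (f x)) ≡ 1

module _ {X Y : Set} (ΔX : KroneckerDelta X) (ΔY : KroneckerDelta Y) {xs : List X} {ys : List Y}
         {p : X → Bool} {q : Y → Bool} {f : X → Y} {g : Y → X} where

  iverson*δ-swap : ∀ x y → Transfers ΔY ys p q f g x → Transfers ΔX xs q p g f y →
                   iverson (p x) * δ ΔY (f x) y ≡ iverson (q y) * δ ΔX (g y) x
  iverson*δ-swap x y fx gy with p x in px | q y in qy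
  ... | false | false = refl
  ... | true  | false with δ-dec ΔY (f x) y
  ...   | inj₁ refl = ⊥-elim (true≢false (trans (sym (proj₁ (fx refl))) qy))
    where true≢false : true ≢ false
          true≢false ()
  ...   | inj₂ δ≡0  = trans (+-identityʳ _) δ≡0
  iverson*δ-swap x y fx gy | false | true with δ-dec ΔX (g y) x
  ...   | inj₁ refl = ⊥-elim (true≢false (trans (sym (proj₁ (gy refl))) px))
    where true≢false : true ≢ false
          true≢false ()
  ...   | inj₂ δ≡0  = sym (trans (+-identityʳ _) δ≡0)
  iverson*δ-swap x y fx gy | true | true with δ-dec ΔY (f x) y | δ-dec ΔX (g y) x
  ...   | inj₁ refl | _         = cong (_+ 0) (trans (δ-refl ΔY (f x))
                                    (sym (trans (cong (λ x′ → δ ΔX x′ x) (proj₁ (proj₂ (fx refl)))) (δ-refl ΔX x))))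
  ...   | inj₂ δ≡0  | inj₁ refl = ⊥-elim (0≢1+n (trans (sym δ≡0)
                                    (trans (cong (λ y′ → δ ΔY y′ y) (proj₁ (proj₂ (gy refl)))) (δ-refl ΔY y))))
  ...   | inj₂ δ≡0  | inj₂ δ′≡0 = cong (_+ 0) (trans δ≡0 (sym δ′≡0))

  ∑-iverson-transfer : All (Transfers ΔY ys p q f g) xs → All (Transfers ΔX xs q p g f) ys →
                       ∑ xs (λ x → iverson (p x)) ≡ ∑ ys (λ y → iverson (q y))
  ∑-iverson-transfer fxs gys = begin
    ∑ xs (λ x → iverson (p x))                            ≡⟨ ∑-congᴬ fxs (λ x fx → once-in-ys x fx) ⟩
    ∑ xs (λ x → iverson (p x) * ∑ ys (δ ΔY (f x)))       ≡⟨ ∑-cong xs (λ x → sym (∑-*ˡ ys (iverson (p x)) _)) ⟩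
    ∑ xs (λ x → ∑ ys (λ y → iverson (p x) * δ ΔY (f x) y)) ≡⟨ ∑-congᴬ fxs (λ x fx → ∑-congᴬ gys (λ y gy → iverson*δ-swap x y fx gy)) ⟩
    ∑ xs (λ x → ∑ ys (λ y → iverson (q y) * δ ΔX (g y) x)) ≡⟨ ∑-comm xs ys _ ⟩
    ∑ ys (λ y → ∑ xs (λ x → iverson (q y) * δ ΔX (g y) x)) ≡⟨ ∑-cong ys (λ y → ∑-*ˡ xs (iverson (q y)) _) ⟩
    ∑ ys (λ y → iverson (q y) * ∑ xs (δ ΔX (g y)))       ≡⟨ ∑-congᴬ gys (λ y gy → sym (once-in-xs y gy)) ⟩
    ∑ ys (λ y → iverson (q y))                            ∎
    where
    open ≡-Reasoning
    once-in-ys : ∀ x → Transfers ΔY ys p q f g x → iverson (p x) ≡ iverson (p x) * ∑ ys (δ ΔY (f x))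
    once-in-ys x fx with p x
    ... | false = refl
    ... | true  = sym (trans (+-identityʳ _) (proj₂ (proj₂ (fx refl))))
    once-in-xs : ∀ y → Transfers ΔX xs q p g f y → iverson (q y) ≡ iverson (q y) * ∑ xs (δ ΔX (g y))
    once-in-xs y gy with q y
    ... | false = refl
    ... | true  = sym (trans (+-identityʳ _) (proj₂ (proj₂ (gy refl))))

All-words-length : ∀ n → All (λ w → length w ≡ n) (words n)
All-words-length n = All.map proj₁ (All-listsOf {Q = λ _ → ⊤} allSteps (_ ∷ _ ∷ _ ∷ []) n)

∑-δStep-allSteps : ∀ s → ∑ allSteps (δ deltaStep s) ≡ 1
∑-δStep-allSteps U = refl
∑-δStep-allSteps F = refl
∑-δStep-allSteps D = refl

∑-δ-words : ∀ n w → length w ≡ n → ∑ (words n) (δList (δ deltaStep) w) ≡ 1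
∑-δ-words n w refl = trans (∑-δList-listsOf (δ deltaStep) allSteps n w (All.tabulate (λ {s} _ → ∑-δStep-allSteps s)))
                           (δ-refl deltaℕ (length w))

tableauToWord : ℕ → List (List ℕ) → List Step
tableauToWord n x = wordOf n (fromFilling x)

wordToTableau : List Step → List (List ℕ)
wordToTableau w = toFilling (positions 1 w)

tableaux-transfer : ∀ n x → ShapedFilling n x →
  Transfers (deltaList deltaStep) (words n) (isSYT n) (ballotFrom false 0) (tableauToWord n) wordToTableau x
tableaux-transfer n x filling syt =
  wordOf-ballot n t standard ,
  trans (cong toFilling (positions-wordOf n t standard)) roundTrip ,
  ∑-δ-words n (wordOf n t) (length-wordOf n t)
  where
  t = fromFilling x
  standard = proj₁ (isSYT-standard n x filling syt)
  roundTrip = proj₂ (isSYT-standard n x filling syt)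

words-transfer : ∀ n w → length w ≡ n →
  Transfers (deltaList (deltaList deltaℕ)) (tableauFillings n) (ballotFrom false 0) (isSYT n) wordToTableau (tableauToWord n) w
words-transfer n w refl ballot =
  standard-isSYT n t standard ,
  trans (cong (wordOf n) (fromFilling-toFilling (Standard-shaped standard))) (wordOf-positions w) ,
  ∑-δ-tableauFillings n (toFilling t) entries∈ partition thirdPart≤1
  where
  t = positions 1 w
  standard = positions-standard w ballot
  open ShapedFilling (standard-shapedFilling n t standard)

theorem3p3 : (n : ℕ) → HM n + 1 ≡ S21 n
theorem3p3 n = begin
  HM n + 1                                             ≡⟨ cong (_+ 1) (HM≡humpsFrom n) ⟩
  humpsFrom 0 n + 1                                    ≡⟨ humpsFrom+1≡tableauWords n ⟩
  tableauWords 0 n                                     ≡⟨ sym (∑-ballotFrom n 0) ⟩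
  ∑ (words n) (λ w → iverson (ballotFrom false 0 w))   ≡⟨ sym bijection ⟩
  ∑ (tableauFillings n) (λ x → iverson (isSYT n x))    ≡⟨ sym (S21≡∑isSYT n) ⟩
  S21 n                                                ∎
  where
  open ≡-Reasoning
  bijection = ∑-iverson-transfer (deltaList (deltaList deltaℕ)) (deltaList deltaStep) {f = tableauToWord n} {g = wordToTableau}
    (All.map (λ {x} → tableaux-transfer n x) (All-tableauFillings n))
    (All.map (λ {w} → words-transfer n w) (All-words-length n))
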